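{- Let $k, m, n$ be integers with $k > 1$, $m > 6$, $n > 7$ and $2^m \equiv 1 \pmod n$, and let $X = B(k,m,n)$. Up to reversal, every $6$-cycle in $X$ through the vertex $(0,\mathbf{0})$, written starting at $(0,\mathbf{0})$, has exactly one of the following forms, where $r,s,t \in \{1,\dots,k-1\}$ are pairwise distinct whenever they appear and $2^{ -1}$ denotes the inverse of $2$ modulo $n$: (1) $(0,\mathbf{0}) \sim (1,\mathbf{0}) \sim (2,2\mathbf{e}_r) \sim (1,2\mathbf{e}_r) \sim (0,\mathbf{e}_r) \sim (1,\mathbf{e}_r) \sim (0,\mathbf{0})$; (2) $(0,\mathbf{0}) \sim (1,\mathbf{0}) \sim (0,-\mathbf{e}_r) \sim (1,-\mathbf{e}_r) \sim (2,\mathbf{e}_r) \sim (1,\mathbf{e}_r) \sim (0,\mathbf{0})$; (3) $(0,\mathbf{0}) \sim (1,\mathbf{0}) \sim (0,-\mathbf{e}_r) \sim (1,\mathbf{e}_s-\mathbf{e}_r) \sim (0,\mathbf{e}_s-\mathbf{e}_r) \sim (1,\mathbf{e}_s) \sim (0,\mathbf{0})$; (4) $(0,\mathbf{0}) \sim (1,\mathbf{0}) \sim (0,-\mathbf{e}_r) \sim (-1,-\mathbf{e}_r) \sim (0,-2^{ -1}\mathbf{e}_r) \sim (-1,-2^{ -1}\mathbf{e}_r) \sim (0,\mathbf{0})$; (5) $(0,\mathbf{0}) \sim (1,\mathbf{e}_r) \sim (2,2\mathbf{e}_s+\mathbf{e}_r) \sim (1,2\mathbf{e}_s-\mathbf{e}_r)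 \sim (0,\mathbf{e}_s-\mathbf{e}_r) \sim (1,\mathbf{e}_s) \sim (0,\mathbf{0})$; (6) $(0,\mathbf{0}) \sim (1,\mathbf{e}_r) \sim (0,\mathbf{e}_r) \sim (1,\mathbf{e}_s+\mathbf{e}_r) \sim (0,\mathbf{e}_s) \sim (1,\mathbf{e}_s) \sim (0,\mathbf{0})$; (7) $(0,\mathbf{0}) \sim (1,\mathbf{e}_r) \sim (0,\mathbf{e}_r) \sim (-1,2^{ -1}\mathbf{e}_r) \sim (0,2^{ -1}\mathbf{e}_r) \sim (-1,\mathbf{0}) \sim (0,\mathbf{0})$; (8) $(0,\mathbf{0}) \sim (1,\mathbf{e}_r) \sim (0,\mathbf{e}_r-\mathbf{e}_s) \sim (1,\mathbf{e}_r-\mathbf{e}_s+\mathbf{e}_t) \sim (0,\mathbf{e}_t-\mathbf{e}_s) \sim (1,\mathbf{e}_t) \sim (0,\mathbf{0})$; (9) $(0,\mathbf{0}) \sim (1,\mathbf{e}_r) \sim (0,\mathbf{e}_r-\mathbf{e}_s) \sim (-1,2^{ -1}\mathbf{e}_r-\mathbf{e}_s) \sim (0,2^{ -1}\mathbf{e}_r-2^{ -1}\mathbf{e}_s) \sim (-1,-2^{ -1}\mathbf{e}_s) \sim (0,\mathbf{0})$; (10) $(0,\mathbf{0}) \sim (-1,\mathbf{0}) \sim (0,2^{ -1}\mathbf{e}_r) \sim (1,2^{ -1}\mathbf{e}_r) \sim (0,-2^{ -1}\mathbf{e}_r) \sim (-1,-2^{ -1}\mathbf{e}_r) \sim (0,\mathbf{0})$;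 (11) $(0,\mathbf{0}) \sim (-1,\mathbf{0}) \sim (0,2^{ -1}\mathbf{e}_r) \sim (-1,2^{ -1}\mathbf{e}_r-2^{ -1}\mathbf{e}_s) \sim (0,2^{ -1}\mathbf{e}_r-2^{ -1}\mathbf{e}_s) \sim (-1,-2^{ -1}\mathbf{e}_s) \sim (0,\mathbf{0})$; (12) $(0,\mathbf{0}) \sim (-1,\mathbf{0}) \sim (-2,-2^{ -2}\mathbf{e}_r) \sim (-1,-2^{ -2}\mathbf{e}_r) \sim (-2,-2^{ -1}\mathbf{e}_r) \sim (-1,-2^{ -1}\mathbf{e}_r) \sim (0,\mathbf{0})$; (13) $(0,\mathbf{0}) \sim (-1,-2^{ -1}\mathbf{e}_r) \sim (0,-2^{ -1}\mathbf{e}_r) \sim (-1,-2^{ -1}\mathbf{e}_r-2^{ -1}\mathbf{e}_s) \sim (0,-2^{ -1}\mathbf{e}_s) \sim (-1,-2^{ -1}\mathbf{e}_s) \sim (0,\mathbf{0})$; (14) $(0,\mathbf{0}) \sim (-1,-2^{ -1}\mathbf{e}_r) \sim (0,-2^{ -1}\mathbf{e}_r+2^{ -1}\mathbf{e}_s) \sim (1,2^{ -1}\mathbf{e}_r+2^{ -1}\mathbf{e}_s) \sim (0,2^{ -1}\mathbf{e}_r-2^{ -1}\mathbf{e}_s) \sim (-1,-2^{ -1}\mathbf{e}_s) \sim (0,\mathbf{0})$; (15) $(0,\mathbf{0}) \sim (-1,-2^{ -1}\mathbf{e}_r) \sim (0,-2^{ -1}\mathbf{e}_r+2^{ -1}\mathbf{e}_s)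 \sim (-1,-2^{ -1}\mathbf{e}_r+2^{ -1}\mathbf{e}_s-2^{ -1}\mathbf{e}_t) \sim (0,2^{ -1}\mathbf{e}_s-2^{ -1}\mathbf{e}_t) \sim (-1,-2^{ -1}\mathbf{e}_t) \sim (0,\mathbf{0})$; (16) $(0,\mathbf{0}) \sim (-1,-2^{ -1}\mathbf{e}_r) \sim (-2,-2^{ -1}\mathbf{e}_r-2^{ -2}\mathbf{e}_s) \sim (-1,-2^{ -2}\mathbf{e}_r-2^{ -2}\mathbf{e}_s) \sim (-2,-2^{ -2}\mathbf{e}_r-2^{ -1}\mathbf{e}_s) \sim (-1,-2^{ -1}\mathbf{e}_s) \sim (0,\mathbf{0})$.
   Context: For integers $k,m,n > 1$ with $2^m \equiv 1 \pmod n$ (so $n$ is odd and $2$ is a unit mod $n$), the Bouwer graph $B(k,m,n)$ has vertex set $\mathbb{Z}_m \times (\mathbb{Z}_n)^{k-1}$; write a vertex as $(a,\mathbf{b})$, and $\mathbf{0}$ for the zero vector. Let $\mathbf{e}_j$ ($1 \le j \le k-1$) denote the $j$th standard basis vector of $(\mathbb{Z}_n)^{k-1}$. Two vertices are adjacent (written $\sim$) if and only if they can be written as $(a,\mathbf{b})$ and $(a+1,\mathbf{c})$ where either $\mathbf{c} = \mathbf{b}$ or $\mathbf{c} = \mathbf{b} + 2^a \mathbf{e}_j$ for some $j$. A $6$-cycle is a closed walk of length $6$ with six distinct vertices. -}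

module Defs where

open import Data.Nat using (ℕ; _+_; _*_; _∸_; _^_; NonZero)
open import Data.Nat.DivMod using (_%_; m%n<n)
open import Data.Fin using (Fin; toℕ; fromℕ<)
open import Data.Vec using (Vec; []; _∷_; replicate; zipWith; map; _[_]≔_)
open import Data.Product using (Σ; ∃; ∃-syntax; _×_; _,_)
open import Data.Sum using (_⊎_)
open import Relation.Binary.PropositionalEquality using (_≡_; _≢_)
open import Relation.Nullary using (¬_)

module Zmod (n : ℕ) {{_ : NonZero n}} where
  [_] : ℕ → Fin n
  [ x ] = fromℕ< (m%n<n x n)

  _+ₙ_ : Fin n → Fin n → Fin n
  a +ₙ b = [ toℕ a + toℕ b ]

  _*ₙ_ : Fin n → Fin n → Fin n
  a *ₙ b = [ toℕ a * toℕ b ]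

  -ₙ_ : Fin n → Fin n
  -ₙ a = [ n ∸ toℕ a ]

ExactlyOne : {A : Set} → (A → Set) → Set
ExactlyOne {A} P = Σ A (λ i → P i × ((j : A) → P j → i ≡ j))

module Bouwer (k m n : ℕ) {{_ : NonZero m}} {{_ : NonZero n}} where
  open Zmod m using () renaming ([_] to [_]ₘ; _+ₙ_ to _+ₘ_; -ₙ_ to -ₘ_)
  open Zmod n

  d : ℕ
  d = k ∸ 1

  Vect : Set
  Vect = Vec (Fin n) d

  Vertex : Set
  Vertex = Fin m × Vect

  𝟎 : Vect
  𝟎 = replicate d [ 0 ]

  e : Fin d → Vect
  e j = 𝟎 [ j ]≔ [ 1 ]

  _⊕_ : Vect → Vect → Vect
  _⊕_ = zipWith _+ₙ_

  ⊝_ : Vect → Vect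
  ⊝ v = map -ₙ_ v

  _⊖_ : Vect → Vect → Vect
  u ⊖ v = u ⊕ (⊝ v)

  _·_ : Fin n → Vect → Vect
  c · v = map (c *ₙ_) v

  infixl 6 _⊕_ _⊖_
  infix 8 _·_
  infix 7 ⊝_

  -- 2^a in Z_n for a ∈ Z_m (well defined since 2^m ≡ 1 mod n)
  pow2 : Fin m → Fin n
  pow2 a = [ 2 ^ toℕ a ]

  Step : Vertex → Vertex → Set
  Step (a , b) (a' , c) = (a' ≡ a +ₘ [ 1 ]ₘ) × (c ≡ b ⊎ ∃[ j ] c ≡ b ⊕ pow2 a · e j)

  _∼_ : Vertex → Vertex → Set
  u ∼ v = Step u v ⊎ Step v u

  origin : Vertex
  origin = ([ 0 ]ₘ , 𝟎)

  Cyc : Set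
  Cyc = Vec Vertex 6

  IsSixCycle : Cyc → Set
  IsSixCycle (v0 ∷ v1 ∷ v2 ∷ v3 ∷ v4 ∷ v5 ∷ []) =
    (v0 ∼ v1) × (v1 ∼ v2) × (v2 ∼ v3) × (v3 ∼ v4) × (v4 ∼ v5) × (v5 ∼ v0) ×
    (v0 ≢ v1) × (v0 ≢ v2) × (v0 ≢ v3) × (v0 ≢ v4) × (v0 ≢ v5) ×
    (v1 ≢ v2) × (v1 ≢ v3) × (v1 ≢ v4) × (v1 ≢ v5) ×
    (v2 ≢ v3) × (v2 ≢ v4) × (v2 ≢ v5) ×
    (v3 ≢ v4) × (v3 ≢ v5) ×
    (v4 ≢ v5)

  rev : Cyc → Cyc
  rev (v0 ∷ v1 ∷ v2 ∷ v3 ∷ v4 ∷ v5 ∷ []) = v0 ∷ v5 ∷ v4 ∷ v3 ∷ v2 ∷ v1 ∷ []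

  0ₘ 1ₘ 2ₘ -1ₘ -2ₘ : Fin m
  0ₘ = [ 0 ]ₘ
  1ₘ = [ 1 ]ₘ
  2ₘ = [ 2 ]ₘ
  -1ₘ = -ₘ [ 1 ]ₘ
  -2ₘ = -ₘ [ 2 ]ₘ

  cyc : Vertex → Vertex → Vertex → Vertex → Vertex → Vertex → Cyc
  cyc a b c d f g = a ∷ b ∷ c ∷ d ∷ f ∷ g ∷ []

  Distinct3 : Fin d → Fin d → Fin d → Set
  Distinct3 r s t = (r ≢ s) × (r ≢ t) × (s ≢ t)

  -- The sixteen forms; h plays the role of 2^{-1} mod n, h2 = h*h of 2^{-2}.
  module Forms (h : Fin n) where
    two : Fin n
    two = [ 2 ]

    h2 : Fin n
    h2 = h *ₙ h

    F1 F2 F3 F4 F5 F6 F7 F8 F9 F10 F11 F12 F13 F14 F15 F16 : Cyc → Set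
    F1 c = ∃[ r ] c ≡ cyc (0ₘ , 𝟎) (1ₘ , 𝟎) (2ₘ , two · e r) (1ₘ , two · e r) (0ₘ , e r) (1ₘ , e r)
    F2 c = ∃[ r ] c ≡ cyc (0ₘ , 𝟎) (1ₘ , 𝟎) (0ₘ , ⊝ e r) (1ₘ , ⊝ e r) (2ₘ , e r) (1ₘ , e r)
    F3 c = ∃[ r ] ∃[ s ] r ≢ s × c ≡ cyc (0ₘ , 𝟎) (1ₘ , 𝟎) (0ₘ , ⊝ e r) (1ₘ , e s ⊖ e r) (0ₘ , e s ⊖ e r) (1ₘ , e s)
    F4 c = ∃[ r ] c ≡ cyc (0ₘ , 𝟎) (1ₘ , 𝟎) (0ₘ , ⊝ e r) (-1ₘ , ⊝ e r) (0ₘ , ⊝ h · e r) (-1ₘ , ⊝ h · e r)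
    F5 c = ∃[ r ] ∃[ s ] r ≢ s × c ≡ cyc (0ₘ , 𝟎) (1ₘ , e r) (2ₘ , two · e s ⊕ e r) (1ₘ , two · e s ⊖ e r) (0ₘ , e s ⊖ e r) (1ₘ , e s)
    F6 c = ∃[ r ] ∃[ s ] r ≢ s × c ≡ cyc (0ₘ , 𝟎) (1ₘ , e r) (0ₘ , e r) (1ₘ , e s ⊕ e r) (0ₘ , e s) (1ₘ , e s)
    F7 c = ∃[ r ] c ≡ cyc (0ₘ , 𝟎) (1ₘ , e r) (0ₘ , e r) (-1ₘ , h · e r) (0ₘ , h · e r) (-1ₘ , 𝟎)
    F8 c = ∃[ r ] ∃[ s ] ∃[ t ] Distinct3 r s t × c ≡ cyc (0ₘ , 𝟎) (1ₘ , e r) (0ₘ , e r ⊖ e s) (1ₘ , e r ⊖ e s ⊕ e t) (0ₘ , e t ⊖ e s) (1ₘ , e t)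
    F9 c = ∃[ r ] ∃[ s ] r ≢ s × c ≡ cyc (0ₘ , 𝟎) (1ₘ , e r) (0ₘ , e r ⊖ e s) (-1ₘ , h · e r ⊖ e s) (0ₘ , h · e r ⊖ h · e s) (-1ₘ , ⊝ h · e s)
    F10 c = ∃[ r ] c ≡ cyc (0ₘ , 𝟎) (-1ₘ , 𝟎) (0ₘ , h · e r) (1ₘ , h · e r) (0ₘ , ⊝ h · e r) (-1ₘ , ⊝ h · e r)
    F11 c = ∃[ r ] ∃[ s ] r ≢ s × c ≡ cyc (0ₘ , 𝟎) (-1ₘ , 𝟎) (0ₘ , h · e r) (-1ₘ , h · e r ⊖ h · e s) (0ₘ , h · e r ⊖ h · e s) (-1ₘ , ⊝ h · e s)
    F12 c = ∃[ r ] c ≡ cyc (0ₘ , 𝟎) (-1ₘ , 𝟎) (-2ₘ , ⊝ h2 · e r) (-1ₘ , ⊝ h2 · e r) (-2ₘ , ⊝ h · e r) (-1ₘ , ⊝ h · e r)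
    F13 c = ∃[ r ] ∃[ s ] r ≢ s × c ≡ cyc (0ₘ , 𝟎) (-1ₘ , ⊝ h · e r) (0ₘ , ⊝ h · e r) (-1ₘ , ⊝ h · e r ⊖ h · e s) (0ₘ , ⊝ h · e s) (-1ₘ , ⊝ h · e s)
    F14 c = ∃[ r ] ∃[ s ] r ≢ s × c ≡ cyc (0ₘ , 𝟎) (-1ₘ , ⊝ h · e r) (0ₘ , ⊝ h · e r ⊕ h · e s) (1ₘ , h · e r ⊕ h · e s) (0ₘ , h · e r ⊖ h · e s) (-1ₘ , ⊝ h · e s)
    F15 c = ∃[ r ] ∃[ s ] ∃[ t ] Distinct3 r s t × c ≡ cyc (0ₘ , 𝟎) (-1ₘ , ⊝ h · e r) (0ₘ , ⊝ h · e r ⊕ h · e s) (-1ₘ , ⊝ h · e r ⊕ h · e s ⊖ h · e t) (0ₘ , h · e s ⊖ h · e t) (-1ₘ , ⊝ h · e t)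
    F16 c = ∃[ r ] ∃[ s ] r ≢ s × c ≡ cyc (0ₘ , 𝟎) (-1ₘ , ⊝ h · e r) (-2ₘ , ⊝ h · e r ⊖ h2 · e s) (-1ₘ , ⊝ h2 · e r ⊖ h2 · e s) (-2ₘ , ⊝ h2 · e r ⊖ h · e s) (-1ₘ , ⊝ h · e s)

    forms : Vec (Cyc → Set) 16
    forms = F1 ∷ F2 ∷ F3 ∷ F4 ∷ F5 ∷ F6 ∷ F7 ∷ F8 ∷ F9 ∷ F10 ∷ F11 ∷ F12 ∷ F13 ∷ F14 ∷ F15 ∷ F16 ∷ []

  open import Data.Vec using (lookup)

  -- c has form number i (0-based index into the list (1)..(16)) up to reversal
  HasForm : Fin n → Fin 16 → Cyc → Set
  HasForm h i c = lookup (Forms.forms h) i c ⊎ lookup (Forms.forms h) i (rev c)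

-- A six-cycle through (0, 𝟎) is a closed walk of six edges, each moving one level up or down and either keeping the
-- vector or adding 2^ℓ e_j, where ℓ is the lower of its two levels. Since m > 6, the levels of a closed walk of length six
-- are the integers in [-3, 3]; after scaling by 8, every vertex is an integer combination of the unit vectors e_j used by
-- the walk, at most six of them, named by the first edge that uses them. Up to this renaming there are 64 direction
-- sequences and 877 label patterns, and a decision procedure, run by evaluation, shows that each of them either cannot
-- return to the origin (some coordinate ends as 2^j·x/8 with 0 < |x| < 8 ≤ n), or repeats a vertex, or is one of the
-- sixteen forms traversed in one of its two directions. It also shows that no two forms share a direction sequence and
-- label pattern, which is why the form is unique. The integer computation is transported to ℤ_m × (ℤ_n)^(k-1) by reading
-- a level z as z mod m and an integer combination Y as h³·Y mod n, h³ being the inverse of 8.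

module Submission where

open import Defs
open import Data.Nat using (ℕ; _<_; _^_; NonZero)
open import Data.Nat.DivMod using (_%_)
open import Data.Fin using (Fin)
open import Data.Vec using (head)
open import Relation.Binary.PropositionalEquality using (_≡_)

open import Data.Bool using (Bool; true; false; T; _∧_; _∨_; not; if_then_else_)
import Data.Bool.Properties as BoolP
open import Data.Bool.ListAction using (all; any)
open import Data.Empty using (⊥; ⊥-elim)
open import Data.Fin as Fin using (zero; suc; toℕ; inject₁; fromℕ; fromℕ<)
import Data.Fin.Properties as FinP
open import Data.Integer as ℤ using (ℤ; +_; -[1+_]; _+_; _-_; _*_; -_; ∣_∣; 0ℤ; 1ℤ)
open import Data.Integer.Divisibility.Signed using (_∣_; divides; ∣m∣n⇒∣m+n; ∣m⇒∣-m; ∣n⇒∣m*n; ∣m⇒∣m*n; ∣⇒∣ᵤ)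
import Data.Integer.Properties as ℤP
open import Algebra.Properties.Semiring.Sum ℤP.+-*-semiring using (sum; sum-cong-≗; ∑-distrib-+; *-distribˡ-sum)
open import Data.Integer.Tactic.RingSolver using (solve-∀)
open import Data.List using (List; []; _∷_; allFin; concatMap; map; filter; upTo)
open import Data.List.Membership.Propositional using (_∈_; find)
open import Data.List.Membership.Propositional.Properties using
    (∈-allFin; ∈-map⁺; ∈-concatMap⁺; ∈-concatMap⁻; ∈-filter⁺)
import Data.List.Relation.Unary.All as All
open import Data.List.Relation.Unary.All.Properties using (all⁺; all⁻)
open import Data.List.Relation.Unary.Any as Any using (here; there)
open import Data.List.Relation.Unary.Any.Properties using (any⁻)
open import Data.Maybe using (Maybe; just; nothing; fromMaybe; is-just; is-nothing; maybe; _>>=_)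
import Data.Maybe.Properties as MaybeP
open import Data.Nat as ℕ using (zero; suc; _%_; _/_; _∸_; z≤n; s≤s)
open import Data.Nat.DivMod using (m≡m%n+[m/n]*n; m%n<n)
import Data.Nat.Divisibility as ℕ∣
import Data.Nat.Properties as ℕP
open import Data.Product using (_×_; _,_; proj₁; proj₂; ∃; ∃-syntax)
open import Data.Sum using (_⊎_; inj₁; inj₂; [_,_]′)
open import Data.Unit using (tt)
open import Data.Vec as Vec using (Vec; []; _∷_; lookup; tabulate; _∷ʳ_)
import Data.Vec.Properties as VecP
open import Data.Vec.Relation.Binary.Pointwise.Inductive as Pointwise using (Pointwise; []; _∷_)
open import Data.Vec.Relation.Binary.Pointwise.Extensional using (ext; Pointwise-≡⇒≡)
open import Data.Vec.Relation.Unary.All using (All; []; _∷_)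
open import Data.Vec.Relation.Unary.AllPairs using ([]; _∷_)
open import Data.Vec.Relation.Unary.Unique.Propositional using (Unique)
open import Function using (_∘_; _⇔_; mk⇔; Equivalence)
open import Relation.Binary.PropositionalEquality hiding ([_])
open import Relation.Nullary using (Dec; yes; no; does; ¬_)
open import Relation.Nullary.Decidable using (dec-true; dec-false)

does-sound : ∀ {A : Set} (a? : Dec A) → T (does a?) → A
does-sound (yes a) _ = a

not-does-sound : ∀ {A : Set} (a? : Dec A) → T (not (does a?)) → ¬ A
not-does-sound (no ¬a) _ = ¬a

does-complete : ∀ {A : Set} (a? : Dec A) → A → T (does a?)
does-complete a? a = subst T (sym (dec-true a? a)) tt

∧-proj₁ : ∀ {a b} → T (a ∧ b) → T a
∧-proj₁ = proj₁ ∘ Equivalence.to BoolP.T-∧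

∧-proj₂ : ∀ {a b} → T (a ∧ b) → T b
∧-proj₂ {a} = proj₂ ∘ Equivalence.to (BoolP.T-∧ {a})

T-not : ∀ {b} → T (not b) → ¬ T b
T-not {true} () _

modus-ponens : ∀ {a b} → T (not a ∨ b) → T a → T b
modus-ponens {true} t _ = t

∧-intro : ∀ {a b} → T a → T b → T (a ∧ b)
∧-intro ta tb = Equivalence.from BoolP.T-∧ (ta , tb)

∨-elim : ∀ {a b} → T (a ∨ b) → T a ⊎ T b
∨-elim = Equivalence.to BoolP.T-∨

all-∈ : ∀ {A : Set} (p : A → Bool) {xs x} → T (all p xs) → x ∈ xs → T (p x)
all-∈ p {xs} t = All.lookup (all⁺ p xs t)

-- For the closed checker results, a type T (all p xs) would be normalised by the type checker, re-running the check.
all-∈-true : ∀ {A : Set} (p : A → Bool) {xs x} → all p xs ≡ true → x ∈ xs → T (p x)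
all-∈-true p {xs} eq = all-∈ p {xs} (subst T (sym eq) tt)

all-allFin : ∀ {n} (p : Fin n → Bool) → T (all p (allFin n)) → ∀ i → T (p i)
all-allFin p t i = all-∈ p {allFin _} t (∈-allFin i)

allFin-all : ∀ {n} (p : Fin n → Bool) → (∀ i → T (p i)) → T (all p (allFin n))
allFin-all {n} p f = all⁻ p {allFin n} (All.tabulate (λ {i} _ → f i))

any-∃ : ∀ {A : Set} (p : A → Bool) xs → T (any p xs) → ∃[ x ] x ∈ xs × T (p x)
any-∃ p xs t = find (any⁻ p xs t)

does-cong : ∀ {A B : Set} (a? : Dec A) (b? : Dec B) → (A → B) → (B → A) → does a? ≡ does b?
does-cong (yes _) (yes _) _ _ = refl
does-cong (no _) (no _) _ _ = refl
does-cong (yes a) (no ¬b) f _ = ⊥-elim (¬b (f a))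
does-cong (no ¬a) (yes b) _ g = ⊥-elim (¬a (g b))

first : ∀ {n} → (Fin n → Bool) → Maybe (Fin n)
first {zero} p = nothing
first {suc n} p = if p zero then just zero else Data.Maybe.map suc (first (p ∘ suc))

first-sound : ∀ {n} (p : Fin n → Bool) {j} → first p ≡ just j → T (p j)
first-sound {suc n} p eq with p zero in p0
first-sound {suc n} p refl | true = subst T (sym p0) tt
first-sound {suc n} p eq | false with first (p ∘ suc) in eq′
first-sound {suc n} p refl | false | just j = first-sound (p ∘ suc) eq′

first-least : ∀ {n} (p : Fin n → Bool) {i j} → first p ≡ just j → T (p i) → j Fin.≤ i
first-least {suc n} p eq pi with p zero in p0
first-least {suc n} p refl pi | true = z≤n
first-least {suc n} p {zero} eq pi | false = ⊥-elim (subst T p0 pi)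
first-least {suc n} p {suc i} eq pi | false with first (p ∘ suc) in eq′
first-least {suc n} p {suc i} refl pi | false | just j = s≤s (first-least (p ∘ suc) eq′ pi)

first-exists : ∀ {n} (p : Fin n → Bool) {i} → T (p i) → ∃[ j ] first p ≡ just j
first-exists {suc n} p {i} pi with p zero in p0
... | true = zero , refl
first-exists {suc n} p {zero} pi | false = ⊥-elim (subst T p0 pi)
first-exists {suc n} p {suc i} pi | false with first-exists (p ∘ suc) pi
... | j , eq rewrite eq = suc j , refl

first-none : ∀ {n} (p : Fin n → Bool) → (∀ i → p i ≡ false) → first p ≡ nothing
first-none {zero} p none = refl
first-none {suc n} p none rewrite none zero | first-none (p ∘ suc) (none ∘ suc) = refl

first-cong : ∀ {n} {p q : Fin n → Bool} → (∀ i → p i ≡ q i) → first p ≡ first q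
first-cong {zero} eq = refl
first-cong {suc n} eq rewrite eq zero | first-cong (eq ∘ suc) = refl

allVecs : ∀ {A : Set} {n} → (Fin n → List A) → List (Vec A n)
allVecs {n = zero} opts = [] ∷ []
allVecs {n = suc n} opts = concatMap (λ x → map (x ∷_) (allVecs (opts ∘ suc))) (opts zero)

∈-allVecs : ∀ {A : Set} {n} (opts : Fin n → List A) (v : Vec A n) → (∀ i → lookup v i ∈ opts i) → v ∈ allVecs opts
∈-allVecs {n = zero} opts [] _ = here refl
∈-allVecs {n = suc n} opts (x ∷ v) mem =
  ∈-concatMap⁺ (λ y → map (y ∷_) (allVecs (opts ∘ suc)))
      (Any.map (λ { refl → ∈-map⁺ (x ∷_) (∈-allVecs (opts ∘ suc) v (mem ∘ suc)) }) (mem zero))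

sum-zero : ∀ {n} (f : Fin n → ℤ) → (∀ j → f j ≡ 0ℤ) → sum f ≡ 0ℤ
sum-zero {zero} f _ = refl
sum-zero {suc n} f z = cong₂ _+_ (z zero) (sum-zero (f ∘ suc) (z ∘ suc))

sum-single : ∀ {n} (f : Fin n → ℤ) i → (∀ j → j ≢ i → f j ≡ 0ℤ) → sum f ≡ f i
sum-single {suc n} f zero others =
  trans (cong₂ _+_ (refl {x = f zero}) (sum-zero (f ∘ suc) (λ j → others (suc j) λ ()))) (ℤP.+-identityʳ (f zero))
sum-single {suc n} f (suc i) others =
  trans (cong₂ _+_ (others zero λ ()) (sum-single (f ∘ suc) i (λ j j≢i → others (suc j) (j≢i ∘ FinP.suc-injective))))
        (ℤP.+-identityˡ (f (suc i)))

module Congruence (n : ℕ) {{_ : NonZero n}} where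
  open Zmod n

  infix 4 _≋_ _~_

  record _≋_ (a b : ℤ) : Set where
    constructor mk≋
    field n∣a-b : + n ∣ a - b

  private
    ∣-transport : ∀ {x c d} → x ≡ c - d → + n ∣ x → c ≋ d
    ∣-transport eq p = mk≋ (subst (+ n ∣_) eq p)

  ≋-reflexive : ∀ {a b} → a ≡ b → a ≋ b
  ≋-reflexive {a} refl = mk≋ (divides 0ℤ (ℤP.+-inverseʳ a))

  ≋-refl : ∀ {a} → a ≋ a
  ≋-refl = ≋-reflexive refl

  ≋-sym : ∀ {a b} → a ≋ b → b ≋ a
  ≋-sym {a} {b} p = ∣-transport (flip a b) (∣m⇒∣-m (_≋_.n∣a-b p))
    where flip : ∀ a b → - (a - b) ≡ b - a
          flip = solve-∀

  ≋-trans : ∀ {a b c} → a ≋ b → b ≋ c → a ≋ c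
  ≋-trans {a} {b} {c} p q = ∣-transport (telescope a b c) (∣m∣n⇒∣m+n (_≋_.n∣a-b p) (_≋_.n∣a-b q))
    where telescope : ∀ a b c → (a - b) + (b - c) ≡ a - c
          telescope = solve-∀

  ≋-+ : ∀ {a b c d} → a ≋ b → c ≋ d → a + c ≋ b + d
  ≋-+ {a} {b} {c} {d} p q = ∣-transport (regroup a b c d) (∣m∣n⇒∣m+n (_≋_.n∣a-b p) (_≋_.n∣a-b q))
    where regroup : ∀ a b c d → (a - b) + (c - d) ≡ (a + c) - (b + d)
          regroup = solve-∀

  ≋-neg : ∀ {a b} → a ≋ b → - a ≋ - b
  ≋-neg {a} {b} p = ∣-transport (regroup a b) (∣m⇒∣-m (_≋_.n∣a-b p))
    where regroup : ∀ a b → - (a - b) ≡ - a - - b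
          regroup = solve-∀

  ≋-* : ∀ {a b c d} → a ≋ b → c ≋ d → a * c ≋ b * d
  ≋-* {a} {b} {c} {d} p q = ∣-transport (regroup a b c d)
      (∣m∣n⇒∣m+n (∣m⇒∣m*n c (_≋_.n∣a-b p)) (∣n⇒∣m*n b (_≋_.n∣a-b q)))
    where regroup : ∀ a b c d → (a - b) * c + b * (c - d) ≡ a * c - b * d
          regroup = solve-∀

  n≋0 : + n ≋ 0ℤ
  n≋0 = mk≋ (divides (+ 1) (trans (ℤP.+-identityʳ (+ n)) (sym (ℤP.*-identityˡ (+ n)))))

  ≋0⇒≡0 : ∀ {a} → a ≋ 0ℤ → ∣ a ∣ ℕ.< n → a ≡ 0ℤ
  ≋0⇒≡0 {a} (mk≋ p) a<n with ∣ a ∣ in eq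
  ... | zero = ℤP.∣i∣≡0⇒i≡0 eq
  ... | suc _ = ⊥-elim (ℕ∣.>⇒∤ a<n (subst (n ℕ∣.∣_) (trans (cong ∣_∣ (ℤP.+-identityʳ a)) eq) (∣⇒∣ᵤ p)))

  _~_ : Fin n → ℤ → Set
  x ~ a = + toℕ x ≋ a

  ~-unique : ∀ {x y a} → x ~ a → y ~ a → x ≡ y
  ~-unique {x} {y} {a} p q = FinP.toℕ-injective (ℤP.+-injective (ℤP.i-j≡0⇒i≡j _ _ (≋0⇒≡0 difference bound)))
    where
      difference : + toℕ x - + toℕ y ≋ 0ℤ
      difference = ≋-trans (≋-+ p (≋-neg q)) (≋-reflexive (ℤP.+-inverseʳ a))
      bound : ∣ + toℕ x - + toℕ y ∣ ℕ.< n
      bound = subst (ℕ._< n) (sym (cong ∣_∣ (ℤP.m-n≡m⊖n (toℕ x) (toℕ y))))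
                (ℕP.≤-<-trans (ℤP.∣m⊝n∣≤m⊔n (toℕ x) (toℕ y)) (ℕP.⊔-lub (FinP.toℕ<n x) (FinP.toℕ<n y)))

  []-~ : ∀ x → [ x ] ~ + x
  []-~ x = mk≋ (divides (- + (x / n))
      (trans (cong (λ r → + r - + x) (FinP.toℕ-fromℕ< (m%n<n x n))) (remainder {x % n} {x / n} (m≡m%n+[m/n]*n x n))))
    where
      remainder : ∀ {r q x} → x ≡ r ℕ.+ q ℕ.* n → + r - + x ≡ (- + q) * + n
      remainder {r} {q} refl = trans
          (cong (λ t → + r - t) (trans (ℤP.pos-+ r (q ℕ.* n)) (cong (λ t → + r + t) (ℤP.pos-* q n))))
          (cancel (+ r) (+ q) (+ n))
        where cancel : ∀ r q n → r - (r + q * n) ≡ (- q) * n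
              cancel = solve-∀

  +ₙ-~ : ∀ {x y a b} → x ~ a → y ~ b → x +ₙ y ~ a + b
  +ₙ-~ {x} {y} p q = ≋-trans ([]-~ (toℕ x ℕ.+ toℕ y)) (≋-trans (≋-reflexive (ℤP.pos-+ (toℕ x) (toℕ y))) (≋-+ p q))

  *ₙ-~ : ∀ {x y a b} → x ~ a → y ~ b → x *ₙ y ~ a * b
  *ₙ-~ {x} {y} p q = ≋-trans ([]-~ (toℕ x ℕ.* toℕ y)) (≋-trans (≋-reflexive (ℤP.pos-* (toℕ x) (toℕ y))) (≋-* p q))

  -ₙ-~ : ∀ {x a} → x ~ a → -ₙ x ~ - a
  -ₙ-~ {x} p = ≋-trans ([]-~ (n ℕ.∸ toℕ x))
      (≋-trans (≋-reflexive monus)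
      (≋-trans (≋-+ n≋0 (≋-refl { - + toℕ x})) (≋-trans (≋-reflexive (ℤP.+-identityˡ (- + toℕ x))) (≋-neg p))))
    where
      monus : + (n ℕ.∸ toℕ x) ≡ + n - + toℕ x
      monus = trans (sym (ℤP.⊖-≥ (ℕP.<⇒≤ (FinP.toℕ<n x)))) (sym (ℤP.m-n≡m⊖n n (toℕ x)))

  ≋-cancel : ∀ {u v x} → v * u ≋ + 1 → u * x ≋ 0ℤ → x ≋ 0ℤ
  ≋-cancel {u} {v} {x} vu≋1 ux≋0 =
    ≋-trans (≋-reflexive (sym (ℤP.*-identityˡ x)))
      (≋-trans (≋-* (≋-sym vu≋1) (≋-refl {x}))
        (≋-trans (≋-reflexive (ℤP.*-assoc v u x)) (≋-trans (≋-* (≋-refl {v}) ux≋0) (≋-reflexive (ℤP.*-zeroʳ v)))))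

module PowersOfTwo (m n : ℕ) {{_ : NonZero m}} {{_ : NonZero n}}
               (2^m%n≡1 : 2 ^ m % n ≡ 1 % n)
               (h : Fin n) (h*2≡1 : Zmod._*ₙ_ n h (Zmod.[_] n 2) ≡ Zmod.[_] n 1) where
  open Zmod n
  open Congruence n
  module Level = Congruence m

  ĥ : ℤ
  ĥ = + toℕ h

  ĥ*2≋1 : ĥ * + 2 ≋ + 1
  ĥ*2≋1 = ≋-trans (≋-sym (*ₙ-~ {h} ≋-refl ([]-~ 2))) (≋-trans (≋-reflexive (cong (λ t → + toℕ t) h*2≡1)) ([]-~ 1))

  eighth : ℤ
  eighth = ĥ * ĥ * ĥ

  eighth*8≋1 : eighth * + 8 ≋ + 1
  eighth*8≋1 = ≋-trans (≋-reflexive (regroup ĥ)) (≋-* (≋-* ĥ*2≋1 ĥ*2≋1) ĥ*2≋1)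
    where regroup : ∀ h → h * h * h * + 8 ≡ (h * + 2) * (h * + 2) * (h * + 2)
          regroup = solve-∀

  ĥ^j*2^j≋1 : ∀ j → ĥ ℤ.^ j * + (2 ^ j) ≋ + 1
  ĥ^j*2^j≋1 zero = ≋-refl
  ĥ^j*2^j≋1 (suc j) = ≋-trans
      (≋-reflexive (trans (cong (ĥ * ĥ ℤ.^ j *_) (ℤP.pos-* 2 (2 ^ j))) (regroup ĥ (ĥ ℤ.^ j) (+ (2 ^ j)))))
                               (≋-* ĥ*2≋1 (ĥ^j*2^j≋1 j))
    where regroup : ∀ h a b → h * a * (+ 2 * b) ≡ (h * + 2) * (a * b)
          regroup = solve-∀

  2^m≋1 : + (2 ^ m) ≋ + 1
  2^m≋1 = ≋-trans (≋-sym ([]-~ (2 ^ m))) (≋-trans (≋-reflexive (cong +_ residues)) ([]-~ 1))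
    where residues : toℕ [ 2 ^ m ] ≡ toℕ [ 1 ]
          residues = trans (FinP.toℕ-fromℕ< (m%n<n (2 ^ m) n)) (trans 2^m%n≡1 (sym (FinP.toℕ-fromℕ< (m%n<n 1 n))))

  2^[m*q]≋1 : ∀ q → + (2 ^ (m ℕ.* q)) ≋ + 1
  2^[m*q]≋1 zero rewrite ℕP.*-zeroʳ m = ≋-refl
  2^[m*q]≋1 (suc q) = ≋-trans (≋-reflexive (cong +_ split))
      (≋-trans (≋-reflexive (ℤP.pos-* (2 ^ m) _)) (≋-* 2^m≋1 (2^[m*q]≋1 q)))
    where split : 2 ^ (m ℕ.* suc q) ≡ 2 ^ m ℕ.* 2 ^ (m ℕ.* q)
          split = trans (cong (2 ^_) (ℕP.*-suc m q)) (ℕP.^-distribˡ-+-* 2 m (m ℕ.* q))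

  2^x≋2^[x%m] : ∀ x → + (2 ^ x) ≋ + (2 ^ (x % m))
  2^x≋2^[x%m] x = ≋-trans (≋-reflexive (cong +_ split)) (≋-trans (≋-reflexive (ℤP.pos-* (2 ^ (x % m)) _))
                    (≋-trans (≋-* (≋-refl {+ (2 ^ (x % m))}) (2^[m*q]≋1 (x / m))) (≋-reflexive (ℤP.*-identityʳ _))))
    where split : 2 ^ x ≡ 2 ^ (x % m) ℕ.* 2 ^ (m ℕ.* (x / m))
          split = trans (cong (2 ^_) (trans (m≡m%n+[m/n]*n x m) (cong (x % m ℕ.+_) (ℕP.*-comm (x / m) m))))
                        (ℕP.^-distribˡ-+-* 2 (x % m) (m ℕ.* (x / m)))

  2^-periodic : ∀ {x y} → + x Level.≋ + y → + (2 ^ x) ≋ + (2 ^ y)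
  2^-periodic {x} {y} x≋y = ≋-trans (2^x≋2^[x%m] x)
      (≋-trans (≋-reflexive (cong (λ r → + (2 ^ r)) same%)) (≋-sym (2^x≋2^[x%m] y)))
    where
      toℕ[] : ∀ x → toℕ (Zmod.[_] m x) ≡ x % m
      toℕ[] x = FinP.toℕ-fromℕ< (m%n<n x m)
      same% : x % m ≡ y % m
      same% = trans (sym (toℕ[] x))
          (trans (cong toℕ (Level.~-unique (Level.[]-~ x) (Level.≋-trans (Level.[]-~ y) (Level.≋-sym x≋y))))
          (toℕ[] y))

  pow2-~ : ∀ {a : Fin m} {z} → a Level.~ z → 0ℤ ℤ.≤ z + + 3 → [ 2 ^ toℕ a ] ~ eighth * + (2 ^ ∣ z + + 3 ∣)
  pow2-~ {a} {z} a~z 0≤z+3 =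
    ≋-trans ([]-~ (2 ^ toℕ a))
      (≋-trans (≋-reflexive (sym (ℤP.*-identityˡ _)))
        (≋-trans (≋-* (≋-sym eighth*8≋1) ≋-refl)
          (≋-trans (≋-reflexive shift)
            (≋-* (≋-refl {eighth}) (2^-periodic level)))))
    where
      shift : eighth * + 8 * + (2 ^ toℕ a) ≡ eighth * + (2 ^ (toℕ a ℕ.+ 3))
      shift = trans (ℤP.*-assoc eighth (+ 8) _)
                (cong (eighth *_) (trans (sym (ℤP.pos-* 8 (2 ^ toℕ a)))
                  (cong +_ (trans (ℕP.*-comm 8 (2 ^ toℕ a)) (sym (ℕP.^-distribˡ-+-* 2 (toℕ a) 3))))))
      level : + (toℕ a ℕ.+ 3) Level.≋ + ∣ z + + 3 ∣
      level = Level.≋-trans (Level.≋-reflexive (ℤP.pos-+ (toℕ a) 3))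
                (Level.≋-trans (Level.≋-+ a~z (Level.≋-refl {+ 3})) (Level.≋-reflexive (sym (ℤP.0≤i⇒+∣i∣≡i 0≤z+3))))

  eighth*2^t-cancel : ∀ t {x} → eighth * (+ (2 ^ t) * x) ≋ 0ℤ → x ≋ 0ℤ
  eighth*2^t-cancel t {x} p = ≋-cancel {eighth * + (2 ^ t)} {+ 8 * ĥ ℤ.^ t} inverse
      (≋-trans (≋-reflexive (ℤP.*-assoc eighth (+ (2 ^ t)) x)) p)
    where
      inverse : (+ 8 * ĥ ℤ.^ t) * (eighth * + (2 ^ t)) ≋ + 1
      inverse = ≋-trans (≋-reflexive (regroup eighth (ĥ ℤ.^ t) (+ (2 ^ t)))) (≋-* eighth*8≋1 (ĥ^j*2^j≋1 t))
        where regroup : ∀ a b c → (+ 8 * b) * (a * c) ≡ (a * + 8) * (b * c)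
              regroup = solve-∀

-- nothing: the edge keeps the vector; just s: it changes the coordinate named s.
Slot : Set
Slot = Maybe (Fin 6)

Coeffs : Set
Coeffs = Fin 6 → ℤ

SymVertex : Set
SymVertex = ℤ × Coeffs

-- 8·2^ℓ: with coordinates scaled by 8, the edges between levels ℓ and ℓ + 1, ℓ ≥ -3, carry integer weights.
weight : ℤ → ℤ
weight ℓ = + (2 ^ ∣ ℓ + + 3 ∣)

addAt : Coeffs → Slot → ℤ → Coeffs
addAt Y nothing c = Y
addAt Y (just s) c s′ = Y s′ + (if does (s′ Fin.≟ s) then c else 0ℤ)

nextLevel : Bool → ℤ → ℤ
nextLevel true z = z + 1ℤ
nextLevel false z = z - 1ℤ

stepWeight : Bool → ℤ → ℤ
stepWeight true z = weight z
stepWeight false z = - weight (z - 1ℤ)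

step : Bool → Slot → SymVertex → SymVertex
step d s (z , Y) = nextLevel d z , addAt Y s (stepWeight d z)

walk : ∀ {k} → SymVertex → Vec Bool k → Vec Slot k → Vec SymVertex (suc k)
walkFrom : ∀ {k} → SymVertex → Vec Bool k → Vec Slot k → Vec SymVertex k
walk v ds sl = v ∷ walkFrom v ds sl
walkFrom v [] [] = []
walkFrom v (d ∷ ds) (s ∷ sl) = walk (step d s v) ds sl

start : SymVertex
start = 0ℤ , λ _ → 0ℤ

finalLevel : ∀ {k} → ℤ → Vec Bool k → ℤ
finalLevel z [] = z
finalLevel z (d ∷ ds) = finalLevel (nextLevel d z) ds

infix 4 _==_ _==ˢ_ _==ᶠ_
_==_ : ℤ → ℤ → Bool
a == b = does (a ℤP.≟ b)

_==ᶠ_ : ∀ {k} → Fin k → Fin k → Bool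
a ==ᶠ b = does (a Fin.≟ b)

_==ˢ_ : Slot → Slot → Bool
a ==ˢ b = does (MaybeP.≡-dec Fin._≟_ a b)

sameCoeffs : Coeffs → Coeffs → Bool
sameCoeffs Y Y′ = all (λ s → Y s == Y′ s) (allFin 6)

sameVertex : SymVertex → SymVertex → Bool
sameVertex (z , Y) (z′ , Y′) = (z == z′) ∧ sameCoeffs Y Y′

isRoot : Vec Slot 6 → Fin 6 → Bool
isRoot sl s = lookup sl s ==ˢ just s

halve : ℤ → ℤ
halve (+ n) = + (n ℕ./ 2)
halve -[1+ n ] = - + (suc n ℕ./ 2)

isEven : ℤ → Bool
isEven a = halve a + halve a == a

data Scalar : Set where
  two half quarter : Scalar

data VecExpr : Set where
  𝟘 : VecExpr
  𝐞 : Fin 3 → VecExpr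
  _⊕ᵉ_ _⊖ᵉ_ : VecExpr → VecExpr → VecExpr
  ⊝ᵉ_ : VecExpr → VecExpr
  _·ᵉ_ : Scalar → VecExpr → VecExpr

infixl 6 _⊕ᵉ_ _⊖ᵉ_
infix 8 _·ᵉ_
infix 7 ⊝ᵉ_

eval : (Fin 3 → Fin 6) → VecExpr → Coeffs
eval σ 𝟘 s = 0ℤ
eval σ (𝐞 i) s = if s ==ᶠ σ i then + 8 else 0ℤ
eval σ (a ⊕ᵉ b) s = eval σ a s + eval σ b s
eval σ (a ⊖ᵉ b) s = eval σ a s - eval σ b s
eval σ (⊝ᵉ a) s = - eval σ a s
eval σ (two ·ᵉ a) s = + 2 * eval σ a s
eval σ (half ·ᵉ a) s = halve (eval σ a s)
eval σ (quarter ·ᵉ a) s = halve (halve (eval σ a s))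

exact : (Fin 3 → Fin 6) → VecExpr → Bool
exact σ 𝟘 = true
exact σ (𝐞 i) = true
exact σ (a ⊕ᵉ b) = exact σ a ∧ exact σ b
exact σ (a ⊖ᵉ b) = exact σ a ∧ exact σ b
exact σ (⊝ᵉ a) = exact σ a
exact σ (two ·ᵉ a) = exact σ a
exact σ (half ·ᵉ a) = exact σ a ∧ all (λ s → isEven (eval σ a s)) (allFin 6)
exact σ (quarter ·ᵉ a) = exact σ a ∧ all (λ s → isEven (eval σ a s) ∧ isEven (halve (eval σ a s))) (allFin 6)

record Shape : Set where
  constructor shape
  field
    arity : ℕ
    vertices : Vec (ℤ × VecExpr) 6

shapes : Vec Shape 16
shapes =
      shape 1 ((+ 0 , 𝟘) ∷ (+ 1 , 𝟘) ∷ (+ 2 , two ·ᵉ 𝐞 r)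
              ∷ (+ 1 , two ·ᵉ 𝐞 r) ∷ (+ 0 , 𝐞 r) ∷ (+ 1 , 𝐞 r) ∷ [])
    ∷ shape 1 ((+ 0 , 𝟘) ∷ (+ 1 , 𝟘) ∷ (+ 0 , ⊝ᵉ 𝐞 r)
              ∷ (+ 1 , ⊝ᵉ 𝐞 r) ∷ (+ 2 , 𝐞 r) ∷ (+ 1 , 𝐞 r) ∷ [])
    ∷ shape 2 ((+ 0 , 𝟘) ∷ (+ 1 , 𝟘) ∷ (+ 0 , ⊝ᵉ 𝐞 r)
              ∷ (+ 1 , 𝐞 s ⊖ᵉ 𝐞 r) ∷ (+ 0 , 𝐞 s ⊖ᵉ 𝐞 r) ∷ (+ 1 , 𝐞 s) ∷ [])
    ∷ shape 1 ((+ 0 , 𝟘) ∷ (+ 1 , 𝟘) ∷ (+ 0 , ⊝ᵉ 𝐞 r)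
              ∷ (- + 1 , ⊝ᵉ 𝐞 r) ∷ (+ 0 , ⊝ᵉ half ·ᵉ 𝐞 r) ∷ (- + 1 , ⊝ᵉ half ·ᵉ 𝐞 r) ∷ [])
    ∷ shape 2 ((+ 0 , 𝟘) ∷ (+ 1 , 𝐞 r) ∷ (+ 2 , two ·ᵉ 𝐞 s ⊕ᵉ 𝐞 r)
              ∷ (+ 1 , two ·ᵉ 𝐞 s ⊖ᵉ 𝐞 r) ∷ (+ 0 , 𝐞 s ⊖ᵉ 𝐞 r) ∷ (+ 1 , 𝐞 s) ∷ [])
    ∷ shape 2 ((+ 0 , 𝟘) ∷ (+ 1 , 𝐞 r) ∷ (+ 0 , 𝐞 r)
              ∷ (+ 1 , 𝐞 s ⊕ᵉ 𝐞 r) ∷ (+ 0 , 𝐞 s) ∷ (+ 1 , 𝐞 s) ∷ [])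
    ∷ shape 1 ((+ 0 , 𝟘) ∷ (+ 1 , 𝐞 r) ∷ (+ 0 , 𝐞 r)
              ∷ (- + 1 , half ·ᵉ 𝐞 r) ∷ (+ 0 , half ·ᵉ 𝐞 r) ∷ (- + 1 , 𝟘) ∷ [])
    ∷ shape 3 ((+ 0 , 𝟘) ∷ (+ 1 , 𝐞 r) ∷ (+ 0 , 𝐞 r ⊖ᵉ 𝐞 s)
              ∷ (+ 1 , 𝐞 r ⊖ᵉ 𝐞 s ⊕ᵉ 𝐞 t) ∷ (+ 0 , 𝐞 t ⊖ᵉ 𝐞 s) ∷ (+ 1 , 𝐞 t) ∷ [])
    ∷ shape 2 ((+ 0 , 𝟘) ∷ (+ 1 , 𝐞 r) ∷ (+ 0 , 𝐞 r ⊖ᵉ 𝐞 s)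
              ∷ (- + 1 , half ·ᵉ 𝐞 r ⊖ᵉ 𝐞 s) ∷ (+ 0 , half ·ᵉ 𝐞 r ⊖ᵉ half ·ᵉ 𝐞 s) ∷ (- + 1 , ⊝ᵉ half ·ᵉ 𝐞 s) ∷ [])
    ∷ shape 1 ((+ 0 , 𝟘) ∷ (- + 1 , 𝟘) ∷ (+ 0 , half ·ᵉ 𝐞 r)
              ∷ (+ 1 , half ·ᵉ 𝐞 r) ∷ (+ 0 , ⊝ᵉ half ·ᵉ 𝐞 r) ∷ (- + 1 , ⊝ᵉ half ·ᵉ 𝐞 r) ∷ [])
    ∷ shape 2 ((+ 0 , 𝟘) ∷ (- + 1 , 𝟘) ∷ (+ 0 , half ·ᵉ 𝐞 r)
              ∷ (- + 1 , half ·ᵉ 𝐞 r ⊖ᵉ half ·ᵉ 𝐞 s) ∷ (+ 0 , half ·ᵉ 𝐞 r ⊖ᵉ half ·ᵉ 𝐞 s)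
              ∷ (- + 1 , ⊝ᵉ half ·ᵉ 𝐞 s) ∷ [])
    ∷ shape 1 ((+ 0 , 𝟘) ∷ (- + 1 , 𝟘) ∷ (- + 2 , ⊝ᵉ quarter ·ᵉ 𝐞 r)
              ∷ (- + 1 , ⊝ᵉ quarter ·ᵉ 𝐞 r) ∷ (- + 2 , ⊝ᵉ half ·ᵉ 𝐞 r) ∷ (- + 1 , ⊝ᵉ half ·ᵉ 𝐞 r) ∷ [])
    ∷ shape 2 ((+ 0 , 𝟘) ∷ (- + 1 , ⊝ᵉ half ·ᵉ 𝐞 r) ∷ (+ 0 , ⊝ᵉ half ·ᵉ 𝐞 r)
              ∷ (- + 1 , ⊝ᵉ half ·ᵉ 𝐞 r ⊖ᵉ half ·ᵉ 𝐞 s) ∷ (+ 0 , ⊝ᵉ half ·ᵉ 𝐞 s) ∷ (- + 1 , ⊝ᵉ half ·ᵉ 𝐞 s) ∷ [])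
    ∷ shape 2 ((+ 0 , 𝟘) ∷ (- + 1 , ⊝ᵉ half ·ᵉ 𝐞 r) ∷ (+ 0 , ⊝ᵉ half ·ᵉ 𝐞 r ⊕ᵉ half ·ᵉ 𝐞 s)
              ∷ (+ 1 , half ·ᵉ 𝐞 r ⊕ᵉ half ·ᵉ 𝐞 s) ∷ (+ 0 , half ·ᵉ 𝐞 r ⊖ᵉ half ·ᵉ 𝐞 s)
              ∷ (- + 1 , ⊝ᵉ half ·ᵉ 𝐞 s) ∷ [])
    ∷ shape 3 ((+ 0 , 𝟘) ∷ (- + 1 , ⊝ᵉ half ·ᵉ 𝐞 r) ∷ (+ 0 , ⊝ᵉ half ·ᵉ 𝐞 r ⊕ᵉ half ·ᵉ 𝐞 s)
              ∷ (- + 1 , ⊝ᵉ half ·ᵉ 𝐞 r ⊕ᵉ half ·ᵉ 𝐞 s ⊖ᵉ half ·ᵉ 𝐞 t) ∷ (+ 0 , half ·ᵉ 𝐞 s ⊖ᵉ half ·ᵉ 𝐞 t)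
              ∷ (- + 1 , ⊝ᵉ half ·ᵉ 𝐞 t) ∷ [])
    ∷ shape 2 ((+ 0 , 𝟘) ∷ (- + 1 , ⊝ᵉ half ·ᵉ 𝐞 r) ∷ (- + 2 , ⊝ᵉ half ·ᵉ 𝐞 r ⊖ᵉ quarter ·ᵉ 𝐞 s)
              ∷ (- + 1 , ⊝ᵉ quarter ·ᵉ 𝐞 r ⊖ᵉ quarter ·ᵉ 𝐞 s) ∷ (- + 2 , ⊝ᵉ quarter ·ᵉ 𝐞 r ⊖ᵉ half ·ᵉ 𝐞 s)
              ∷ (- + 1 , ⊝ᵉ half ·ᵉ 𝐞 s) ∷ [])
    ∷ []
  where
    r s t : Fin 3
    r = zero
    s = suc zero
    t = suc (suc zero)

reverseCycle : ∀ {A : Set} → Vec A 6 → Vec A 6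
reverseCycle (a ∷ b ∷ c ∷ d ∷ e ∷ f ∷ []) = a ∷ f ∷ e ∷ d ∷ c ∷ b ∷ []

orient : ∀ {A : Set} → Bool → Vec A 6 → Vec A 6
orient false v = v
orient true v = reverseCycle v

emb : Fin 3 → Fin 6
emb i = i Fin.↑ˡ 3

record Template : Set where
  field
    form : Fin 16
    arity : ℕ
    vertices : Vec (ℤ × VecExpr) 6
    directions : Vec Bool 6
    slots : Vec Slot 6
    witnesses : Vec (Maybe (Fin 6)) 3

closedWalk : ∀ {A : Set} → Vec A 6 → Vec A 7
closedWalk v = v ∷ʳ Vec.head v

template : Fin 16 → Bool → Template
template i reversed = record
  { form = i
  ; arity = Shape.arity (lookup shapes i)
  ; vertices = vs
  ; directions = tabulate (λ k → proj₁ (next k) == proj₁ (this k) + 1ℤ)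
  ; slots = slots
  ; witnesses = tabulate (λ i → first (λ k → lookup slots k ==ˢ just (emb i)))
  }
  where
    vs = orient reversed (Shape.vertices (lookup shapes i))
    this next : Fin 6 → ℤ × VecExpr
    this k = lookup (closedWalk vs) (inject₁ k)
    next k = lookup (closedWalk vs) (suc k)
    slots : Vec Slot 6
    slots = tabulate (λ k → first (λ s → not (eval emb (proj₂ (next k)) s == eval emb (proj₂ (this k)) s)))

templates : List Template
templates = concatMap (λ i → template i false ∷ template i true ∷ []) (allFin 16)

directionVectors : List (Vec Bool 6)
directionVectors = allVecs (λ _ → true ∷ false ∷ [])

candidatePatterns : List (Vec Slot 6)
candidatePatterns = allVecs (λ k → nothing ∷ map just (filter (Fin._≤? k) (allFin 6)))

isCanonical : Vec Slot 6 → Bool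
isCanonical sl = all (λ k → maybe (isRoot sl) true (lookup sl k)) (allFin 6)

_==ᵛ_ : Vec Bool 6 → Vec Bool 6 → Bool
a ==ᵛ b = does (VecP.≡-dec BoolP._≟_ a b)

_==ᵇ_ : Bool → Bool → Bool
a ==ᵇ b = does (a BoolP.≟ b)

samePattern : Vec Slot 6 → Vec Slot 6 → Bool
samePattern sl sl′ = all agreesAt (allFin 6)
  where
    agreesAt : Fin 6 → Bool
    agreesAt k = (is-nothing (lookup sl k) ==ᵇ is-nothing (lookup sl′ k))
                 ∧ all (λ l → (lookup sl k ==ˢ lookup sl l) ==ᵇ (lookup sl′ k ==ˢ lookup sl′ l)) (allFin 6)

paramSlots : Template → Vec Slot 6 → Fin 3 → Fin 6
paramSlots t sl i = fromMaybe zero (lookup (Template.witnesses t) i >>= lookup sl)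

inRange : ℤ → Bool
inRange z = ∣ z ∣ ℕ.≤ᵇ 3

levelsInRange : Vec SymVertex 7 → Bool
levelsInRange ws = all (λ i → inRange (proj₁ (lookup ws i))) (allFin 7)

nonzero : ℤ → Bool
nonzero a = not (a == 0ℤ)

smallNonzero : List ℤ
smallNonzero = + 1 ∷ + 2 ∷ + 3 ∷ + 4 ∷ + 5 ∷ + 6 ∷ + 7 ∷ - + 1 ∷ - + 2 ∷ - + 3 ∷ - + 4 ∷ - + 5 ∷ - + 6 ∷ - + 7 ∷ []

powerOfTwoTimesSmall : ℤ → Bool
powerOfTwoTimesSmall a = any (λ j → any (λ x → a == + (2 ^ j) * x) smallNonzero) (upTo 6)

finalVertex : Vec SymVertex 7 → SymVertex
finalVertex ws = lookup ws (Fin.fromℕ 6)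

-- Coordinate s of the last vertex is 2^j·x/8 with 0 < |x| < 8 ≤ n (no other slot meets it), so it is not 0 mod n.
cannotReturn : Vec Slot 6 → Vec SymVertex 7 → Bool
cannotReturn sl ws = any (λ s → powerOfTwoTimesSmall (Y s) ∧ isRoot sl s
                               ∧ all (λ s′ → not (nonzero (Y s′)) ∨ isRoot sl s′) (allFin 6)) (allFin 6)
  where Y = proj₂ (finalVertex ws)

occursIn : ∀ {k} → SymVertex → Vec SymVertex k → Bool
occursIn w [] = false
occursIn w (w′ ∷ ws) = sameVertex w w′ ∨ occursIn w ws

repeats : ∀ {k} → Vec SymVertex k → Bool
repeats [] = false
repeats (w ∷ ws) = occursIn w ws ∨ repeats ws

initial : ∀ {A : Set} → Vec A 7 → Vec A 6
initial (a ∷ b ∷ c ∷ d ∷ e ∷ f ∷ _ ∷ []) = a ∷ b ∷ c ∷ d ∷ e ∷ f ∷ []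

matches : (Fin 3 → Fin 6) → ℤ × VecExpr → SymVertex → Bool
matches σ (z , E) (z′ , Y) = (z == z′) ∧ exact σ E ∧ sameCoeffs Y (eval σ E)

vertexMatches : Template → (Fin 3 → Fin 6) → Vec SymVertex 7 → Fin 6 → Bool
vertexMatches t σ ws k = matches σ (lookup (Template.vertices t) k) (lookup ws (inject₁ k))

paramsDistinctRoots : Template → Vec Slot 6 → Bool
paramsDistinctRoots t sl =
  all (λ i → not (below i) ∨ isRoot sl (σ i)) (allFin 3)
  ∧ all (λ i → all (λ j → not (below i ∧ below j ∧ (σ i ==ᶠ σ j)) ∨ (i ==ᶠ j)) (allFin 3)) (allFin 3)
  where σ = paramSlots t sl
        below : Fin 3 → Bool
        below i = toℕ i ℕ.<ᵇ Template.arity t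

templateWalk : Template → Vec SymVertex 7
templateWalk t = walk start (Template.directions t) (Template.slots t)

slotsBelowArity : Template → Bool
slotsBelowArity t =
  all (λ k → fromMaybe true (Data.Maybe.map (λ s → toℕ s ℕ.<ᵇ Template.arity t) (lookup (Template.slots t) k)))
      (allFin 6)

selfConsistent : Template → Bool
selfConsistent t = (Template.arity t ℕ.≤ᵇ 3) ∧ all (vertexMatches t emb (templateWalk t)) (allFin 6)
                   ∧ slotsBelowArity t ∧ sameVertex (finalVertex (templateWalk t)) start

-- 0 < |final level| < 7 ≤ m: the walk does not come back to level 0 of ℤ_m.
misclosed : Vec Bool 6 → Bool
misclosed ds = nonzero (finalLevel 0ℤ ds) ∧ (∣ finalLevel 0ℤ ds ∣ ℕ.<ᵇ 7)

uniqueForm : List Template → Template → Vec Bool 6 → Vec Slot 6 → Bool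
uniqueForm ts t ds sl =
  all (λ t′ → not ((Template.directions t′ ==ᵛ ds) ∧ samePattern (Template.slots t′) sl)
              ∨ (Template.form t′ ==ᶠ Template.form t)) ts

-- The template list is an argument so that, when patterns-settled is evaluated, the derived fields of each template
-- are computed once and shared.
fits : List Template → Vec Bool 6 → Vec Slot 6 → Vec SymVertex 7 → Template → Bool
fits ts ds sl ws t = (Template.directions t ==ᵛ ds) ∧ paramsDistinctRoots t sl
                     ∧ all (vertexMatches t (paramSlots t sl) ws) (allFin 6) ∧ uniqueForm ts t ds sl

settled : List Template → Vec Bool 6 → Vec Slot 6 → Bool
settled ts ds sl = levelsInRange ws ∧ (cannotReturn sl ws ∨ repeats (initial ws) ∨ any (fits ts ds sl ws) ts)
  where ws = walk start ds sl

settledPattern : List Template → Vec Slot 6 → Bool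
settledPattern ts sl = not (isCanonical sl) ∨ all (λ ds → misclosed ds ∨ settled ts ds sl) directionVectors

templates-consistent : all selfConsistent templates ≡ true
templates-consistent = refl

patterns-settled : all (settledPattern templates) candidatePatterns ≡ true
patterns-settled = refl

InjectiveOn : ∀ {A : Set} → (Fin 6 → Set) → (Fin 6 → A) → Set
InjectiveOn P ρ = ∀ {s s′} → P s → P s′ → ρ s ≡ ρ s′ → s ≡ s′

OccursIn : (Fin 6 → Set) → Slot → Set
OccursIn P x = ∀ s → x ≡ just s → P s

map-injective : ∀ {A : Set} {P} {ρ : Fin 6 → A} → InjectiveOn P ρ → ∀ {x y} → OccursIn P x → OccursIn P y →
                Data.Maybe.map ρ x ≡ Data.Maybe.map ρ y → x ≡ y
map-injective inj {nothing} {nothing} _ _ _ = refl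
map-injective inj {just s} {just s′} Ps Ps′ eq = cong just (inj (Ps s refl) (Ps′ s′ refl) (MaybeP.just-injective eq))

∈-directionVectors : ∀ ds → ds ∈ directionVectors
∈-directionVectors ds = ∈-allVecs _ ds (λ i → option (lookup ds i))
  where option : ∀ b → b ∈ true ∷ false ∷ []
        option true = here refl
        option false = there (here refl)

Canonical : Vec Slot 6 → Set
Canonical sl = ∀ k l → lookup sl k ≡ just l → l Fin.≤ k × lookup sl l ≡ just l

canonical-candidate : ∀ {sl} → Canonical sl → sl ∈ candidatePatterns
canonical-candidate {sl} canonical = ∈-allVecs _ sl option
  where
    option : ∀ k → lookup sl k ∈ nothing ∷ map just (filter (Fin._≤? k) (allFin 6))
    option k with lookup sl k in eq
    ... | nothing = here refl
    ... | just l = there (∈-map⁺ just (∈-filter⁺ (Fin._≤? k) (∈-allFin l) (proj₁ (canonical k l eq))))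

canonical-isCanonical : ∀ {sl} → Canonical sl → T (isCanonical sl)
canonical-isCanonical {sl} canonical = allFin-all _ rooted
  where
    rooted : ∀ k → T (maybe (isRoot sl) true (lookup sl k))
    rooted k with lookup sl k in eq
    ... | nothing = tt
    ... | just l = does-complete (MaybeP.≡-dec Fin._≟_ (lookup sl l) (just l)) (proj₂ (canonical k l eq))

module Canonicalisation {d : ℕ} (default : Fin d) (labels : Vec (Maybe (Fin d)) 6) where
  private
    label : Fin 6 → Maybe (Fin d)
    label = lookup labels

  sameLabel : Fin 6 → Fin 6 → Bool
  sameLabel k l = is-just (label k) ∧ does (MaybeP.≡-dec Fin._≟_ (label l) (label k))

  slots : Vec Slot 6
  slots = tabulate (λ k → first (sameLabel k))

  decode : Fin 6 → Fin d
  decode s = fromMaybe default (label s)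

  private
    slot-k : ∀ k → lookup slots k ≡ first (sameLabel k)
    slot-k = VecP.lookup∘tabulate _

    sameLabel-sound : ∀ {k l} → T (sameLabel k l) → label k ≡ just (decode k) × label l ≡ label k
    sameLabel-sound {k} {l} t with label k
    ... | just x = refl , does-sound (MaybeP.≡-dec Fin._≟_ (label l) (just x)) t

    sameLabel-refl : ∀ {k x} → label k ≡ just x → T (sameLabel k k)
    sameLabel-refl {k} {x} eq rewrite eq = does-complete (MaybeP.≡-dec Fin._≟_ (just x) (just x)) refl

    slot-sound : ∀ {k l} → lookup slots k ≡ just l → label k ≡ just (decode k) × label l ≡ label k
    slot-sound {k} eq = sameLabel-sound (first-sound (sameLabel k) (trans (sym (slot-k k)) eq))

    sameLabel-cong : ∀ {k k′} → label k ≡ label k′ → ∀ l → sameLabel k l ≡ sameLabel k′ l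
    sameLabel-cong {k} {k′} eq l rewrite eq = refl

  decodes : ∀ k → Data.Maybe.map decode (lookup slots k) ≡ label k
  decodes k = trans (cong (Data.Maybe.map decode) (slot-k k)) (decodes-as (label k) refl)
    where
      decodes-as : ∀ x → label k ≡ x → Data.Maybe.map decode (first (sameLabel k)) ≡ x
      decodes-as nothing eq = cong (Data.Maybe.map decode)
          (first-none (sameLabel k) (λ l → cong (λ y → is-just y ∧ does (MaybeP.≡-dec Fin._≟_ (label l) y)) eq))
      decodes-as (just x) eq with first-exists (sameLabel k) (sameLabel-refl eq)
      ... | j , found = trans (cong (Data.Maybe.map decode) found)
                          (cong (just ∘ fromMaybe default)
                              (trans (proj₂ (sameLabel-sound (first-sound (sameLabel k) found))) eq))

  canonical : Canonical slots
  canonical k l eq = least , trans (slot-k l)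
      (trans (first-cong (sameLabel-cong (proj₂ (slot-sound eq)))) (trans (sym (slot-k k)) eq))
    where
      least : l Fin.≤ k
      least = first-least (sameLabel k) (trans (sym (slot-k k)) eq) (sameLabel-refl (proj₁ (slot-sound eq)))

  decode-injective : ∀ {s s′} → lookup slots s ≡ just s → lookup slots s′ ≡ just s′ → decode s ≡ decode s′ → s ≡ s′
  decode-injective {s} {s′} root root′ same = MaybeP.just-injective (begin
      just s                   ≡⟨ sym root ⟩
      lookup slots s           ≡⟨ slot-k s ⟩
      first (sameLabel s)      ≡⟨ first-cong (sameLabel-cong labels≡) ⟩
      first (sameLabel s′)     ≡⟨ sym (slot-k s′) ⟩
      lookup slots s′          ≡⟨ root′ ⟩
      just s′                  ∎)
    where
      open ≡-Reasoning
      labels≡ : label s ≡ label s′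
      labels≡ = trans (proj₁ (slot-sound root)) (trans (cong just same) (sym (proj₁ (slot-sound root′))))

samePattern-complete : ∀ {A : Set} {P P′} {ρ ρ′ : Fin 6 → A} {sl sl′ : Vec Slot 6} →
                       InjectiveOn P ρ → InjectiveOn P′ ρ′ →
                       (∀ k → OccursIn P (lookup sl k)) → (∀ k → OccursIn P′ (lookup sl′ k)) →
                       (∀ k → Data.Maybe.map ρ (lookup sl k) ≡ Data.Maybe.map ρ′ (lookup sl′ k)) →
                       T (samePattern sl′ sl)
samePattern-complete {ρ = ρ} {ρ′} {sl} {sl′} inj inj′ occ occ′ agree =
  allFin-all _ λ k → ∧-intro (==ᵇ-refl (nothings k)) (allFin-all _ (λ l → ==ᵇ-refl (equalities k l)))
  where
    ==ᵇ-refl : ∀ {a b} → a ≡ b → T (a ==ᵇ b)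
    ==ᵇ-refl {a} refl = does-complete (a BoolP.≟ a) refl
    nothings : ∀ k → is-nothing (lookup sl′ k) ≡ is-nothing (lookup sl k)
    nothings k with lookup sl k | lookup sl′ k | agree k
    ... | nothing | nothing | _ = refl
    ... | just _ | just _ | _ = refl
    equalities : ∀ k l → (lookup sl′ k ==ˢ lookup sl′ l) ≡ (lookup sl k ==ˢ lookup sl l)
    equalities k l = does-cong (MaybeP.≡-dec Fin._≟_ _ _) (MaybeP.≡-dec Fin._≟_ _ _)
      (λ eq′ → map-injective inj (occ k) (occ l)
          (trans (agree k) (trans (cong (Data.Maybe.map ρ′) eq′) (sym (agree l)))))
      (λ eq → map-injective inj′ (occ′ k) (occ′ l)
          (trans (sym (agree k)) (trans (cong (Data.Maybe.map ρ) eq) (agree l))))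

cut : Fin 6 → Fin 3
cut zero = zero
cut (suc zero) = suc zero
cut (suc (suc _)) = suc (suc zero)

cut-emb : ∀ i → cut (emb i) ≡ i
cut-emb zero = refl
cut-emb (suc zero) = refl
cut-emb (suc (suc zero)) = refl

emb-cut : ∀ s → toℕ s ℕ.< 3 → emb (cut s) ≡ s
emb-cut zero _ = refl
emb-cut (suc zero) _ = refl
emb-cut (suc (suc zero)) _ = refl
emb-cut (suc (suc (suc _))) (s≤s (s≤s (s≤s ())))

∈-templates : ∀ i b → template i b ∈ templates
∈-templates i b = ∈-concatMap⁺ (λ i → template i false ∷ template i true ∷ [])
                    (Any.map (λ { refl → orientation b }) (∈-allFin i))
  where orientation : ∀ b → template i b ∈ template i false ∷ template i true ∷ []
        orientation false = here refl
        orientation true = there (here refl)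

templates-are : ∀ {t} → t ∈ templates → ∃[ i ] ∃[ b ] t ≡ template i b
templates-are t∈ with find (∈-concatMap⁻ (λ i → template i false ∷ template i true ∷ []) {allFin 16} t∈)
... | i , _ , here eq = i , false , eq
... | i , _ , there (here eq) = i , true , eq

closedWalk-head : ∀ {A : Set} (v : Vec A 6) → Vec.head (closedWalk v) ≡ Vec.head v
closedWalk-head (_ ∷ _ ∷ _ ∷ _ ∷ _ ∷ _ ∷ []) = refl

closedWalk-last : ∀ {A : Set} (v : Vec A 6) → lookup (closedWalk v) (fromℕ 6) ≡ Vec.head v
closedWalk-last (_ ∷ _ ∷ _ ∷ _ ∷ _ ∷ _ ∷ []) = refl

closedWalk-inject : ∀ {A : Set} (v : Vec A 6) k → lookup (closedWalk v) (inject₁ k) ≡ lookup v k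
closedWalk-inject (_ ∷ _ ∷ _ ∷ _ ∷ _ ∷ _ ∷ []) zero = refl
closedWalk-inject (_ ∷ _ ∷ _ ∷ _ ∷ _ ∷ _ ∷ []) (suc zero) = refl
closedWalk-inject (_ ∷ _ ∷ _ ∷ _ ∷ _ ∷ _ ∷ []) (suc (suc zero)) = refl
closedWalk-inject (_ ∷ _ ∷ _ ∷ _ ∷ _ ∷ _ ∷ []) (suc (suc (suc zero))) = refl
closedWalk-inject (_ ∷ _ ∷ _ ∷ _ ∷ _ ∷ _ ∷ []) (suc (suc (suc (suc zero)))) = refl
closedWalk-inject (_ ∷ _ ∷ _ ∷ _ ∷ _ ∷ _ ∷ []) (suc (suc (suc (suc (suc zero))))) = refl

pointwise-closedWalk : ∀ {A B : Set} {R : A → B → Set} {ws : Vec A 7} {v : Vec B 6} →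
                       (∀ k → R (lookup ws (inject₁ k)) (lookup v k)) → R (lookup ws (fromℕ 6)) (lookup v zero) →
                       Pointwise R ws (closedWalk v)
pointwise-closedWalk {ws = _ ∷ _ ∷ _ ∷ _ ∷ _ ∷ _ ∷ _ ∷ []} {_ ∷ _ ∷ _ ∷ _ ∷ _ ∷ _ ∷ []} at last =
  at zero ∷ at (suc zero) ∷ at (suc (suc zero)) ∷ at (suc (suc (suc zero))) ∷ at (suc (suc (suc (suc zero))))
    ∷ at (suc (suc (suc (suc (suc zero))))) ∷ last ∷ []

pointwise-initial : ∀ {A B : Set} {R : A → B → Set} {ws : Vec A 7} {v : Vec B 6} →
                    Pointwise R ws (closedWalk v) → Pointwise R (initial ws) v
pointwise-initial {v = _ ∷ _ ∷ _ ∷ _ ∷ _ ∷ _ ∷ []} (r₀ ∷ r₁ ∷ r₂ ∷ r₃ ∷ r₄ ∷ r₅ ∷ _ ∷ []) =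
    r₀ ∷ r₁ ∷ r₂ ∷ r₃ ∷ r₄ ∷ r₅ ∷ []

module BouwerGraph (k m n : ℕ) {{_ : NonZero m}} {{_ : NonZero n}} (6<m : 6 ℕ.< m) (7<n : 7 ℕ.< n)
                  (2^m%n≡1 : 2 ^ m % n ≡ 1 % n)
                  (h : Fin n) (h*2≡1 : Zmod._*ₙ_ n h (Zmod.[_] n 2) ≡ Zmod.[_] n 1) where
  open Bouwer k m n
  open Zmod n
  open Congruence n
  open PowersOfTwo m n 2^m%n≡1 h h*2≡1

  indicator : Fin d → Fin d → ℤ
  indicator q p = if does (q Fin.≟ p) then 1ℤ else 0ℤ

  δ : Maybe (Fin d) → Fin d → ℤ
  δ nothing p = 0ℤ
  δ (just q) p = indicator q p

  project : (Fin 6 → Fin d) → Coeffs → Fin d → ℤ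
  project ρ Y p = sum (λ s → indicator (ρ s) p * Y s)

  project-cong : ∀ ρ {Y Y′} p → (∀ s → Y s ≡ Y′ s) → project ρ Y p ≡ project ρ Y′ p
  project-cong ρ p eq = sum-cong-≗ (λ s → cong (indicator (ρ s) p *_) (eq s))

  project-zero : ∀ ρ p → project ρ (λ _ → 0ℤ) p ≡ 0ℤ
  project-zero ρ p = sum-zero _ (λ s → ℤP.*-zeroʳ (indicator (ρ s) p))

  project-+ : ∀ ρ A B p → project ρ (λ s → A s + B s) p ≡ project ρ A p + project ρ B p
  project-+ ρ A B p = trans (sum-cong-≗ (λ s → ℤP.*-distribˡ-+ (indicator (ρ s) p) (A s) (B s)))
      (∑-distrib-+ (λ s → indicator (ρ s) p * A s) (λ s → indicator (ρ s) p * B s))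

  project-scale : ∀ ρ c A p → project ρ (λ s → c * A s) p ≡ c * project ρ A p
  project-scale ρ c A p = trans (sum-cong-≗ (λ s → swap (indicator (ρ s) p) c (A s)))
      (sym (*-distribˡ-sum c (λ s → indicator (ρ s) p * A s)))
    where swap : ∀ i c a → i * (c * a) ≡ c * (i * a)
          swap = solve-∀

  project-neg : ∀ ρ A p → project ρ (λ s → - A s) p ≡ - project ρ A p
  project-neg ρ A p = trans (project-cong ρ p (λ s → sym (ℤP.-1*i≡-i (A s))))
      (trans (project-scale ρ (- 1ℤ) A p) (ℤP.-1*i≡-i _))

  project-addAt : ∀ ρ Y s c p → project ρ (addAt Y s c) p ≡ project ρ Y p + c * δ (Data.Maybe.map ρ s) p
  project-addAt ρ Y nothing c p = sym (trans (cong (λ t → project ρ Y p + t) (ℤP.*-zeroʳ c)) (ℤP.+-identityʳ _))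
  project-addAt ρ Y (just s) c p =
    trans (project-+ ρ Y (λ s′ → if does (s′ Fin.≟ s) then c else 0ℤ) p)
        (cong (λ t → project ρ Y p + t) (trans (sum-single _ s off) (trans on (ℤP.*-comm _ c))))
    where
      off : ∀ s′ → s′ ≢ s → indicator (ρ s′) p * (if does (s′ Fin.≟ s) then c else 0ℤ) ≡ 0ℤ
      off s′ s′≢s rewrite dec-false (s′ Fin.≟ s) s′≢s = ℤP.*-zeroʳ (indicator (ρ s′) p)
      on : indicator (ρ s) p * (if does (s Fin.≟ s) then c else 0ℤ) ≡ indicator (ρ s) p * c
      on rewrite dec-true (s Fin.≟ s) refl = refl

  project-at : ∀ ρ Y s → (∀ s′ → s′ ≢ s → Y s′ ≡ 0ℤ ⊎ ρ s′ ≢ ρ s) → project ρ Y (ρ s) ≡ Y s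
  project-at ρ Y s others = trans (sum-single _ s off) on
    where
      off : ∀ s′ → s′ ≢ s → indicator (ρ s′) (ρ s) * Y s′ ≡ 0ℤ
      off s′ s′≢s with others s′ s′≢s
      ... | inj₁ Y≡0 rewrite Y≡0 = ℤP.*-zeroʳ (indicator (ρ s′) (ρ s))
      ... | inj₂ ρ≢ rewrite dec-false (ρ s′ Fin.≟ ρ s) ρ≢ = refl
      on : indicator (ρ s) (ρ s) * Y s ≡ Y s
      on rewrite dec-true (ρ s Fin.≟ ρ s) refl = ℤP.*-identityˡ (Y s)

  lookup-𝟎 : ∀ p → lookup 𝟎 p ~ 0ℤ
  lookup-𝟎 p = subst (_~ 0ℤ) (sym (VecP.lookup-replicate p [ 0 ])) ([]-~ 0)

  lookup-e : ∀ j p → lookup (e j) p ~ indicator j p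
  lookup-e j p with j Fin.≟ p
  ... | yes refl = subst (_~ 1ℤ) (sym (VecP.lookup∘update j 𝟎 [ 1 ])) ([]-~ 1)
  ... | no j≢p = subst (_~ 0ℤ) (sym (VecP.lookup∘update′ (j≢p ∘ sym) 𝟎 [ 1 ])) (lookup-𝟎 p)

  lookup-⊕ : ∀ u v p → lookup (u ⊕ v) p ≡ lookup u p +ₙ lookup v p
  lookup-⊕ u v p = VecP.lookup-zipWith _+ₙ_ p u v

  lookup-⊝ : ∀ v p → lookup (⊝ v) p ≡ -ₙ lookup v p
  lookup-⊝ v p = VecP.lookup-map p -ₙ_ v

  lookup-· : ∀ c v p → lookup (c · v) p ≡ c *ₙ lookup v p
  lookup-· c v p = VecP.lookup-map p (c *ₙ_) v

  record Models (ρ : Fin 6 → Fin d) (sv : SymVertex) (v : Vertex) : Set where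
    constructor models
    field
      level : proj₁ v Level.~ proj₁ sv
      coordinates : ∀ p → lookup (proj₂ v) p ~ eighth * project ρ (proj₂ sv) p

  models-start : ∀ ρ → Models ρ start origin
  models-start ρ = models (Level.[]-~ 0) λ p → ≋-trans (lookup-𝟎 p)
      (≋-reflexive (sym (trans (cong (eighth *_) (project-zero ρ p)) (ℤP.*-zeroʳ eighth))))

  models-injective : ∀ {ρ z Y Y′ u v} → Models ρ (z , Y) u → Models ρ (z , Y′) v → (∀ s → Y s ≡ Y′ s) → u ≡ v
  models-injective {ρ} (models a~z b~Y) (models a′~z b′~Y′) Y≡Y′ =
    cong₂ _,_ (Level.~-unique a~z a′~z)
              (Pointwise-≡⇒≡
                  (ext λ p → ~-unique (b~Y p) (subst (λ t → _ ~ eighth * t) (sym (project-cong ρ p Y≡Y′)) (b′~Y′ p))))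

  InRange : ℤ → Set
  InRange z = T (inRange z)

  InRange⇒0≤+3 : ∀ {z} → InRange z → 0ℤ ℤ.≤ z + + 3
  InRange⇒0≤+3 {+ n} _ = ℤ.+≤+ ℕ.z≤n
  InRange⇒0≤+3 { -[1+ 0 ]} _ = ℤ.+≤+ ℕ.z≤n
  InRange⇒0≤+3 { -[1+ 1 ]} _ = ℤ.+≤+ ℕ.z≤n
  InRange⇒0≤+3 { -[1+ 2 ]} _ = ℤ.+≤+ ℕ.z≤n
  InRange⇒0≤+3 { -[1+ suc (suc (suc _)) ]} ()

  direction : ∀ {u v} → u ∼ v → Bool
  direction (inj₁ _) = true
  direction (inj₂ _) = false

  stepLabel : ∀ {u v} → Step u v → Maybe (Fin d)
  stepLabel (_ , inj₁ _) = nothing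
  stepLabel (_ , inj₂ (j , _)) = just j

  label : ∀ {u v} → u ∼ v → Maybe (Fin d)
  label (inj₁ st) = stepLabel st
  label (inj₂ st) = stepLabel st

  step-level : ∀ {a a′ : Fin m} {b c z} → Step (a , b) (a′ , c) → a Level.~ z → a′ Level.~ z + 1ℤ
  step-level {a} (refl , _) a~z = Level.+ₙ-~ a~z (Level.[]-~ 1)

  step-level⁻ : ∀ {a a′ : Fin m} {b c z} → Step (a , b) (a′ , c) → a′ Level.~ z → a Level.~ z - 1ℤ
  step-level⁻ {a} st a′~z =
    Level.≋-trans (Level.≋-reflexive (shift (+ toℕ a)))
      (Level.≋-+ (Level.≋-trans (Level.≋-sym (step-level st (Level.≋-refl {+ toℕ a}))) a′~z) (Level.≋-refl { - 1ℤ}))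
    where shift : ∀ x → x ≡ x + 1ℤ - 1ℤ
          shift = solve-∀

  edge-level : ∀ {u v z} (e : u ∼ v) → proj₁ u Level.~ z → proj₁ v Level.~ nextLevel (direction e) z
  edge-level (inj₁ st) = step-level st
  edge-level (inj₂ st) = step-level⁻ st

  step-coordinates : ∀ {a a′ : Fin m} {b c z} (st : Step (a , b) (a′ , c)) → a Level.~ z → 0ℤ ℤ.≤ z + + 3 →
                     ∀ p → lookup c p ~ + toℕ (lookup b p) + eighth * weight z * δ (stepLabel st) p
  step-coordinates {b = b} {z = z} (_ , inj₁ refl) _ _ p =
    ≋-reflexive (sym
        (trans (cong (λ t → + toℕ (lookup b p) + t) (ℤP.*-zeroʳ (eighth * weight z))) (ℤP.+-identityʳ _)))
  step-coordinates {a} {b = b} (_ , inj₂ (j , refl)) a~z 0≤z+3 p =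
    subst (_~ _) (sym (trans (lookup-⊕ b _ p) (cong (lookup b p +ₙ_) (lookup-· (pow2 a) (e j) p))))
      (+ₙ-~ ≋-refl (*ₙ-~ (pow2-~ a~z 0≤z+3) (lookup-e j p)))

  step-models : ∀ {ρ z Y u v s} (e : u ∼ v) → Models ρ (z , Y) u →
                InRange z → InRange (proj₁ (step (direction e) s (z , Y))) → Data.Maybe.map ρ s ≡ label e →
                Models ρ (step (direction e) s (z , Y)) v
  step-models {ρ} {z} {Y} {s = s} (inj₁ st) (models a~z b~Y) z∈ _ s↦ℓ =
    models (edge-level (inj₁ st) a~z) λ p →
      ≋-trans (step-coordinates st a~z (InRange⇒0≤+3 {z} z∈) p)
        (≋-trans (≋-+ (b~Y p) (≋-refl {eighth * weight z * δ (stepLabel st) p}))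
          (≋-reflexive (trans (collect eighth (project ρ Y p) (weight z) _)
            (cong (eighth *_) (sym (trans (project-addAt ρ Y s (weight z) p)
                                          (cong (λ ℓ → project ρ Y p + weight z * δ ℓ p) s↦ℓ)))))))
    where collect : ∀ e P w i → e * P + e * w * i ≡ e * (P + w * i)
          collect = solve-∀
  step-models {ρ} {z} {Y} {v = v} {s} (inj₂ st) (models a~z b~Y) _ z-1∈ s↦ℓ =
    models (edge-level (inj₂ st) a~z) λ p →
      ≋-trans (≋-reflexive (split (+ toℕ (lookup (proj₂ v) p)) (eighth * weight (z - 1ℤ) * δ (stepLabel st) p)))
        (≋-trans (≋-+ (≋-trans (≋-sym (step-coordinates st a′~z-1 (InRange⇒0≤+3 {z - 1ℤ} z-1∈) p)) (b~Y p)) ≋-refl)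
          (≋-reflexive (trans (collect eighth (project ρ Y p) (weight (z - 1ℤ)) _)
            (cong (eighth *_) (sym (trans (project-addAt ρ Y s (- weight (z - 1ℤ)) p)
                                          (cong (λ ℓ → project ρ Y p + - weight (z - 1ℤ) * δ ℓ p) s↦ℓ)))))))
    where
      a′~z-1 = step-level⁻ st a~z
      split : ∀ x q → x ≡ x + q - q
      split = solve-∀
      collect : ∀ e P w i → e * P - e * w * i ≡ e * (P + - w * i)
      collect = solve-∀

  stepWeight-cancel : ∀ dir z {x} → eighth * (stepWeight dir z * x) ≋ 0ℤ → x ≋ 0ℤ
  stepWeight-cancel true z = eighth*2^t-cancel ∣ z + + 3 ∣
  stepWeight-cancel false z {x} p =
    ≋-trans (≋-reflexive (sym (ℤP.neg-involutive x)))
      (≋-neg (eighth*2^t-cancel ∣ z - 1ℤ + + 3 ∣ (≋-trans (≋-reflexive (move-sign eighth (weight (z - 1ℤ)) x)) p)))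
    where move-sign : ∀ e w x → e * (w * - x) ≡ e * (- w * x)
          move-sign = solve-∀

  δ-01 : ∀ x p → δ x p ≡ 0ℤ ⊎ δ x p ≡ 1ℤ
  δ-01 nothing p = inj₁ refl
  δ-01 (just q) p with does (q Fin.≟ p)
  ... | true = inj₂ refl
  ... | false = inj₁ refl

  1≉0 : ¬ (1ℤ ≋ 0ℤ)
  1≉0 1≋0 with ≋0⇒≡0 1≋0 (ℕP.<-trans (ℕ.s≤s (ℕ.s≤s ℕ.z≤n)) 7<n)
  ... | ()

  δ-≋ : ∀ x y p → δ x p - δ y p ≋ 0ℤ → δ x p ≡ δ y p
  δ-≋ x y p with δ-01 x p | δ-01 y p
  ... | inj₁ x0 | inj₁ y0 = λ _ → trans x0 (sym y0)
  ... | inj₂ x1 | inj₂ y1 = λ _ → trans x1 (sym y1)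
  ... | inj₂ x1 | inj₁ y0 rewrite x1 | y0 = ⊥-elim ∘ 1≉0
  ... | inj₁ x0 | inj₂ y1 rewrite x0 | y1 = ⊥-elim ∘ 1≉0 ∘ ≋-neg

  indicator-self : ∀ q → indicator q q ≡ 1ℤ
  indicator-self q rewrite dec-true (q Fin.≟ q) refl = refl

  indicator-other : ∀ {q p} → q ≢ p → indicator q p ≡ 0ℤ
  indicator-other {q} {p} q≢p rewrite dec-false (q Fin.≟ p) q≢p = refl

  δ-injective : ∀ {x y} → (∀ p → δ x p ≡ δ y p) → x ≡ y
  δ-injective {nothing} {nothing} _ = refl
  δ-injective {just q} {nothing} eq with trans (sym (indicator-self q)) (eq q)
  ... | ()
  δ-injective {nothing} {just q} eq with trans (eq q) (indicator-self q)
  ... | ()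
  δ-injective {just q} {just q′} eq with q Fin.≟ q′
  ... | yes q≡q′ = cong just q≡q′
  ... | no q≢q′ with trans (sym (indicator-other (q≢q′ ∘ sym))) (trans (sym (eq q)) (indicator-self q))
  ... | ()

  opposite-steps : ∀ {a : Fin m} {z} → a Level.~ z + 1ℤ → a Level.~ z - 1ℤ → ⊥
  opposite-steps {z = z} up down with Level.≋0⇒≡0 two≋0 (ℕP.<-trans (ℕ.s≤s (ℕ.s≤s (ℕ.s≤s ℕ.z≤n))) 6<m)
    where
      gap : ∀ z → + 2 ≡ z + 1ℤ - (z - 1ℤ)
      gap = solve-∀
      two≋0 : + 2 Level.≋ 0ℤ
      two≋0 = Level.≋-trans (Level.≋-reflexive (gap z))
                (Level.≋-trans (Level.≋-+ (Level.≋-trans (Level.≋-sym up) down) (Level.≋-refl { - (z - 1ℤ)}))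
                  (Level.≋-reflexive (ℤP.+-inverseʳ (z - 1ℤ))))
  ... | ()

  same-labels : ∀ {ρ ρ′ Y Y′} {b c : Vect} dir z s s′ →
                (∀ p → lookup b p ~ eighth * project ρ Y p) →
                    (∀ p → lookup c p ~ eighth * project ρ (addAt Y s (stepWeight dir z)) p) →
                (∀ p → lookup b p ~ eighth * project ρ′ Y′ p) →
                    (∀ p → lookup c p ~ eighth * project ρ′ (addAt Y′ s′ (stepWeight dir z)) p) →
                Data.Maybe.map ρ s ≡ Data.Maybe.map ρ′ s′
  same-labels {ρ} {ρ′} {Y} {Y′} {b} {c} dir z s s′ b₁ c₁ b₂ c₂ =
    δ-injective λ p → δ-≋ (Data.Maybe.map ρ s) (Data.Maybe.map ρ′ s′) p (stepWeight-cancel dir z (difference p))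
    where
      C = stepWeight dir z
      regroup : ∀ e P₁ P₂ C i₁ i₂ → e * (C * (i₁ - i₂)) ≡ (e * (P₁ + C * i₁) - e * P₁) - (e * (P₂ + C * i₂) - e * P₂)
      regroup = solve-∀
      difference : ∀ p → eighth * (C * (δ (Data.Maybe.map ρ s) p - δ (Data.Maybe.map ρ′ s′) p)) ≋ 0ℤ
      difference p =
        ≋-trans (≋-reflexive (regroup eighth (project ρ Y p) (project ρ′ Y′ p) C
                                      (δ (Data.Maybe.map ρ s) p) (δ (Data.Maybe.map ρ′ s′) p)))
          (≋-trans (≋-+ (≋-+ (≋-sym c₁′) (≋-neg (≋-sym (b₁ p)))) (≋-neg (≋-+ (≋-sym c₂′) (≋-neg (≋-sym (b₂ p))))))
            (≋-reflexive (ℤP.+-inverseʳ (+ toℕ (lookup c p) - + toℕ (lookup b p)))))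
        where
          c₁′ = subst (λ t → lookup c p ~ eighth * t) (project-addAt ρ Y s C p) (c₁ p)
          c₂′ = subst (λ t → lookup c p ~ eighth * t) (project-addAt ρ′ Y′ s′ C p) (c₂ p)

  steps-agree : ∀ {ρ ρ′ z Y Y′ dir dir′ s s′ u v} →
                Models ρ (z , Y) u → Models ρ (step dir s (z , Y)) v →
                Models ρ′ (z , Y′) u → Models ρ′ (step dir′ s′ (z , Y′)) v →
                dir ≡ dir′ × Data.Maybe.map ρ s ≡ Data.Maybe.map ρ′ s′
  steps-agree {z = z} {dir = true} {false} _ (models up _) _ (models down _) = ⊥-elim (opposite-steps {z = z} up down)
  steps-agree {z = z} {dir = false} {true} _ (models down _) _ (models up _) = ⊥-elim (opposite-steps {z = z} up down)
  steps-agree {z = z} {dir = true} {true} {s} {s′} {u} {v} (models _ b₁) (models _ c₁) (models _ b₂) (models _ c₂) =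
    refl , same-labels {b = proj₂ u} {proj₂ v} true z s s′ b₁ c₁ b₂ c₂
  steps-agree {z = z} {dir = false} {false} {s} {s′} {u} {v} (models _ b₁) (models _ c₁) (models _ b₂) (models _ c₂) =
    refl , same-labels {b = proj₂ u} {proj₂ v} false z s s′ b₁ c₁ b₂ c₂

  levelAt : ℤ → Fin m
  levelAt (+ j) = Zmod.[_] m j
  levelAt -[1+ j ] = Zmod.-ₙ_ m (Zmod.[_] m (suc j))

  levelAt-~ : ∀ z → levelAt z Level.~ z
  levelAt-~ (+ j) = Level.[]-~ j
  levelAt-~ -[1+ j ] = Level.-ₙ-~ (Level.[]-~ (suc j))

  scalar : Scalar → Fin n
  scalar two = [ 2 ]
  scalar half = h
  scalar quarter = h *ₙ h

  ⟦_⟧ : VecExpr → (Fin 3 → Fin d) → Vect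
  ⟦ 𝟘 ⟧ ρ = 𝟎
  ⟦ 𝐞 i ⟧ ρ = e (ρ i)
  ⟦ a ⊕ᵉ b ⟧ ρ = ⟦ a ⟧ ρ ⊕ ⟦ b ⟧ ρ
  ⟦ a ⊖ᵉ b ⟧ ρ = ⟦ a ⟧ ρ ⊖ ⟦ b ⟧ ρ
  ⟦ ⊝ᵉ a ⟧ ρ = ⊝ ⟦ a ⟧ ρ
  ⟦ c ·ᵉ a ⟧ ρ = scalar c · ⟦ a ⟧ ρ

  vertexOf : (Fin 3 → Fin d) → ℤ × VecExpr → Vertex
  vertexOf ρ (z , E) = levelAt z , ⟦ E ⟧ ρ

  halve-exact : ∀ a → T (isEven a) → a ≡ + 2 * halve a
  halve-exact a even = trans (sym (does-sound (a′ ℤP.≟ a) even)) (double (halve a))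
    where a′ = halve a + halve a
          double : ∀ x → x + x ≡ + 2 * x
          double = solve-∀

  project-halve : ∀ ρ Y p → (∀ s → T (isEven (Y s))) → project ρ Y p ≡ + 2 * project ρ (halve ∘ Y) p
  project-halve ρ Y p even = trans (project-cong ρ p (λ s → halve-exact (Y s) (even s)))
      (project-scale ρ (+ 2) (halve ∘ Y) p)

  h-halves : ∀ {x P} → x ~ eighth * (+ 2 * P) → h *ₙ x ~ eighth * P
  h-halves {P = P} x~ =
    ≋-trans (*ₙ-~ (≋-refl {ĥ}) x~)
        (≋-trans (≋-reflexive (regroup ĥ eighth P)) (≋-trans (≋-* ĥ*2≋1 ≋-refl) (≋-reflexive (ℤP.*-identityˡ _))))
    where regroup : ∀ h e x → h * (e * (+ 2 * x)) ≡ (h * + 2) * (e * x)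
          regroup = solve-∀

  h²-quarters : ∀ {x P} → x ~ eighth * (+ 2 * (+ 2 * P)) → (h *ₙ h) *ₙ x ~ eighth * P
  h²-quarters {P = P} x~ =
    ≋-trans (*ₙ-~ (*ₙ-~ (≋-refl {ĥ}) (≋-refl {ĥ})) x~)
      (≋-trans (≋-reflexive (regroup ĥ eighth P))
        (≋-trans (≋-* ĥ*2≋1 (≋-* ĥ*2≋1 ≋-refl)) (≋-reflexive (trans (ℤP.*-identityˡ _) (ℤP.*-identityˡ _)))))
    where regroup : ∀ h e x → h * h * (e * (+ 2 * (+ 2 * x))) ≡ (h * + 2) * ((h * + 2) * (e * x))
          regroup = solve-∀

  eval-models : ∀ σ ρ (ρ′ : Fin 3 → Fin d) E → (∀ i → ρ′ i ≡ ρ (σ i)) → T (exact σ E) →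
                ∀ p → lookup (⟦ E ⟧ ρ′) p ~ eighth * project ρ (eval σ E) p
  eval-models σ ρ ρ′ 𝟘 _ _ p =
    ≋-trans (lookup-𝟎 p) (≋-reflexive (sym (trans (cong (eighth *_) (project-zero ρ p)) (ℤP.*-zeroʳ eighth))))
  eval-models σ ρ ρ′ (𝐞 i) ρ′≡ _ p rewrite ρ′≡ i =
    ≋-trans (lookup-e (ρ (σ i)) p)
      (≋-trans (≋-reflexive (sym (ℤP.*-identityˡ _))) (≋-trans (≋-* (≋-sym eighth*8≋1) ≋-refl)
        (≋-reflexive (trans (ℤP.*-assoc eighth (+ 8) _) (cong (eighth *_) (sym unit-vector))))))
    where
      unit-vector : project ρ (eval σ (𝐞 i)) p ≡ + 8 * indicator (ρ (σ i)) p
      unit-vector = trans (project-cong ρ p (λ s → sym (ℤP.+-identityˡ (eval σ (𝐞 i) s))))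
                      (trans (project-addAt ρ (λ _ → 0ℤ) (just (σ i)) (+ 8) p)
                        (trans (cong (λ t → t + + 8 * indicator (ρ (σ i)) p) (project-zero ρ p)) (ℤP.+-identityˡ _)))
  eval-models σ ρ ρ′ (a ⊕ᵉ b) ρ′≡ ex p rewrite lookup-⊕ (⟦ a ⟧ ρ′) (⟦ b ⟧ ρ′) p =
    ≋-trans (+ₙ-~ (eval-models σ ρ ρ′ a ρ′≡ (∧-proj₁ ex) p) (eval-models σ ρ ρ′ b ρ′≡ (∧-proj₂ {exact σ a} ex) p))
      (≋-reflexive (trans (sym (ℤP.*-distribˡ-+ eighth _ _))
          (cong (eighth *_) (sym (project-+ ρ (eval σ a) (eval σ b) p)))))
  eval-models σ ρ ρ′ (a ⊖ᵉ b) ρ′≡ ex p rewrite lookup-⊕ (⟦ a ⟧ ρ′) (⊝ ⟦ b ⟧ ρ′) p | lookup-⊝ (⟦ b ⟧ ρ′) p =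
    ≋-trans (+ₙ-~ (eval-models σ ρ ρ′ a ρ′≡ (∧-proj₁ ex) p)
        (-ₙ-~ (eval-models σ ρ ρ′ b ρ′≡ (∧-proj₂ {exact σ a} ex) p)))
      (≋-reflexive (trans (pull eighth _ _)
        (cong (eighth *_) (sym (trans (project-+ ρ (eval σ a) (λ s → - eval σ b s) p)
                                      (cong (λ t → project ρ (eval σ a) p + t) (project-neg ρ (eval σ b) p)))))))
    where pull : ∀ e x y → e * x + - (e * y) ≡ e * (x + - y)
          pull = solve-∀
  eval-models σ ρ ρ′ (⊝ᵉ a) ρ′≡ ex p rewrite lookup-⊝ (⟦ a ⟧ ρ′) p =
    ≋-trans (-ₙ-~ (eval-models σ ρ ρ′ a ρ′≡ ex p))
      (≋-reflexive (trans (ℤP.neg-distribʳ-* eighth _) (cong (eighth *_) (sym (project-neg ρ (eval σ a) p)))))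
  eval-models σ ρ ρ′ (two ·ᵉ a) ρ′≡ ex p rewrite lookup-· [ 2 ] (⟦ a ⟧ ρ′) p =
    ≋-trans (*ₙ-~ ([]-~ 2) (eval-models σ ρ ρ′ a ρ′≡ ex p))
      (≋-reflexive (trans (swap (+ 2) eighth _) (cong (eighth *_) (sym (project-scale ρ (+ 2) (eval σ a) p)))))
    where swap : ∀ c e x → c * (e * x) ≡ e * (c * x)
          swap = solve-∀
  eval-models σ ρ ρ′ (half ·ᵉ a) ρ′≡ ex p rewrite lookup-· h (⟦ a ⟧ ρ′) p =
    h-halves (subst (λ t → _ ~ eighth * t) (project-halve ρ (eval σ a) p evens)
        (eval-models σ ρ ρ′ a ρ′≡ (∧-proj₁ ex) p))
    where evens = all-allFin (λ s → isEven (eval σ a s)) (∧-proj₂ {exact σ a} ex)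
  eval-models σ ρ ρ′ (quarter ·ᵉ a) ρ′≡ ex p rewrite lookup-· (h *ₙ h) (⟦ a ⟧ ρ′) p =
    h²-quarters (subst (λ t → _ ~ eighth * t) quartered (eval-models σ ρ ρ′ a ρ′≡ (∧-proj₁ ex) p))
    where
      evens = all-allFin (λ s → isEven (eval σ a s) ∧ isEven (halve (eval σ a s))) (∧-proj₂ {exact σ a} ex)
      quartered : project ρ (eval σ a) p ≡ + 2 * (+ 2 * project ρ (halve ∘ halve ∘ eval σ a) p)
      quartered = trans (project-halve ρ (eval σ a) p (∧-proj₁ ∘ evens))
                        (cong (+ 2 *_)
                            (project-halve ρ (halve ∘ eval σ a) p (λ s → ∧-proj₂ {isEven (eval σ a s)} (evens s))))

  infixr 5 _▸_
  data Walk : ∀ {ℓ} → Vec Vertex (suc ℓ) → Set where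
    stop : ∀ {v} → Walk (v ∷ [])
    _▸_ : ∀ {ℓ u v} {vs : Vec Vertex ℓ} → u ∼ v → Walk (v ∷ vs) → Walk (u ∷ v ∷ vs)

  directions : ∀ {ℓ} {vs : Vec Vertex (suc ℓ)} → Walk vs → Vec Bool ℓ
  directions stop = []
  directions (e ▸ w) = direction e ∷ directions w

  labels : ∀ {ℓ} {vs : Vec Vertex (suc ℓ)} → Walk vs → Vec (Maybe (Fin d)) ℓ
  labels stop = []
  labels (e ▸ w) = label e ∷ labels w

  final-level : ∀ {ℓ} {vs : Vec Vertex (suc ℓ)} {z} (w : Walk vs) →
                proj₁ (Vec.head vs) Level.~ z → proj₁ (lookup vs (fromℕ ℓ)) Level.~ finalLevel z (directions w)
  final-level stop a~z = a~z
  final-level (e ▸ w) a~z = final-level w (edge-level e a~z)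

  walk-models : ∀ {ℓ} {vs : Vec Vertex (suc ℓ)} {ρ sv} (w : Walk vs) (sl : Vec Slot ℓ) →
                Models ρ sv (Vec.head vs) →
                (∀ i → InRange (proj₁ (lookup (walk sv (directions w) sl) i))) →
                (∀ i → Data.Maybe.map ρ (lookup sl i) ≡ lookup (labels w) i) →
                Pointwise (Models ρ) (walk sv (directions w) sl) vs
  walk-models stop [] start _ _ = start ∷ []
  walk-models {ρ = ρ} {sv} (e ▸ w) (s ∷ sl) start ranges labelled =
    start ∷ walk-models w sl
        (step-models {ρ} {proj₁ sv} {proj₂ sv} {s = s} e start (ranges zero) (ranges (suc zero)) (labelled zero))
        (ranges ∘ suc) (labelled ∘ suc)

  walks-agree : ∀ {ℓ ρ ρ′ z Y Y′} (ds ds′ : Vec Bool ℓ) (sl sl′ : Vec Slot ℓ) {vs : Vec Vertex (suc ℓ)} →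
                Pointwise (Models ρ) (walk (z , Y) ds sl) vs → Pointwise (Models ρ′) (walk (z , Y′) ds′ sl′) vs →
                ds ≡ ds′ × (∀ i → Data.Maybe.map ρ (lookup sl i) ≡ Data.Maybe.map ρ′ (lookup sl′ i))
  walks-agree [] [] [] [] _ _ = refl , λ ()
  walks-agree (dir ∷ ds) (dir′ ∷ ds′) (s ∷ sl) (s′ ∷ sl′) {u ∷ v ∷ _} (m₀ ∷ ms@(m₁ ∷ _)) (m₀′ ∷ ms′@(m₁′ ∷ _))
    with steps-agree {dir = dir} {dir′} {s} {s′} {u} {v} m₀ m₁ m₀′ m₁′
  ... | refl , s≡s′ with walks-agree ds ds′ sl sl′ ms ms′
  ... | refl , rest = refl , λ { zero → s≡s′ ; (suc i) → rest i }

  sameVertex-sound : ∀ {z z′ Y Y′} → T (sameVertex (z , Y) (z′ , Y′)) → z ≡ z′ × (∀ s → Y s ≡ Y′ s)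
  sameVertex-sound {z} {z′} {Y} {Y′} t =
    does-sound (z ℤP.≟ z′) (∧-proj₁ t) , λ s → does-sound (Y s ℤP.≟ Y′ s)
        (all-allFin (λ s → Y s == Y′ s) (∧-proj₂ {z == z′} t) s)

  occursIn-sound : ∀ {ℓ ρ w v} {ws : Vec SymVertex ℓ} {vs : Vec Vertex ℓ} →
                   Models ρ w v → Pointwise (Models ρ) ws vs → T (occursIn w ws) → ¬ All (v ≢_) vs
  occursIn-sound {w = z , Y} {ws = (z′ , Y′) ∷ ws} m (m′ ∷ ms) t
      (v≢ ∷ vs≢) with ∨-elim {sameVertex (z , Y) (z′ , Y′)} t
  ... | inj₁ same with sameVertex-sound {z} {z′} same
  ...   | refl , Y≡Y′ = v≢ (models-injective m m′ Y≡Y′)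
  occursIn-sound m (_ ∷ ms) t (_ ∷ vs≢) | inj₂ later = occursIn-sound m ms later vs≢

  repeats-sound : ∀ {ℓ ρ} {ws : Vec SymVertex ℓ} {vs : Vec Vertex ℓ} → Pointwise (Models ρ) ws vs → T (repeats ws)
      → ¬ Unique vs
  repeats-sound {ws = w ∷ ws} (m ∷ ms) t (v≢vs ∷ rest-distinct) with ∨-elim {occursIn w ws} t
  ... | inj₁ occurs = occursIn-sound m ms occurs v≢vs
  ... | inj₂ later = repeats-sound ms later rest-distinct

  decompose : ∀ a → T (powerOfTwoTimesSmall a) → ∃[ j ] ∃[ x ] a ≡ + (2 ^ j) ℤ.* x × ∣ x ∣ ℕ.< 8 × x ≢ 0ℤ
  decompose a t with any-∃ _ (upTo 6) t
  ... | j , _ , t′ with any-∃ _ smallNonzero t′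
  ... | x , x∈ , a≡ = j , x , does-sound (a ℤP.≟ _) a≡ , ℕP.<ᵇ⇒< _ _ (∧-proj₁ small) , not-does-sound (x ℤP.≟ 0ℤ)
      (∧-proj₂ {∣ x ∣ ℕ.<ᵇ 8} small)
    where small : T ((∣ x ∣ ℕ.<ᵇ 8) ∧ nonzero x)
          small = all-∈ (λ x → (∣ x ∣ ℕ.<ᵇ 8) ∧ nonzero x) {smallNonzero} tt x∈

  cannotReturn-sound : ∀ {ρ sl} {ws : Vec SymVertex 7} → InjectiveOn (T ∘ isRoot sl) ρ →
                       Models ρ (finalVertex ws) origin → ¬ T (cannotReturn sl ws)
  cannotReturn-sound {ρ} {sl} {ws} roots-injective (models _ coordinates) fails with any-∃ _ (allFin 6) fails
  ... | s , _ , conditions = refute (decompose (Y s) (∧-proj₁ {powerOfTwoTimesSmall (Y s)} conditions))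
    where
      Y = proj₂ (finalVertex ws)
      root = ∧-proj₁ {isRoot sl s} (∧-proj₂ {powerOfTwoTimesSmall (Y s)} conditions)
      rooted = ∧-proj₂ {isRoot sl s} (∧-proj₂ {powerOfTwoTimesSmall (Y s)} conditions)
      others : ∀ s′ → s′ ≢ s → Y s′ ≡ 0ℤ ⊎ ρ s′ ≢ ρ s
      others s′ s′≢s with ∨-elim {not (nonzero (Y s′))}
                            (all-allFin (λ s′ → not (nonzero (Y s′)) ∨ isRoot sl s′) rooted s′)
      ... | inj₁ vanishes = inj₁ (does-sound (Y s′ ℤP.≟ 0ℤ) (subst T (BoolP.not-involutive _) vanishes))
      ... | inj₂ root′ = inj₂ (λ eq → s′≢s (roots-injective root′ root eq))
      eighth*Y≋0 : eighth ℤ.* Y s ≋ 0ℤ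
      eighth*Y≋0 = ≋-trans (≋-sym (subst (λ t → lookup 𝟎 (ρ s) ~ eighth ℤ.* t) (project-at ρ Y s others) (coordinates (ρ s))))
                           (lookup-𝟎 (ρ s))
      refute : ∃[ j ] ∃[ x ] Y s ≡ + (2 ^ j) ℤ.* x × ∣ x ∣ ℕ.< 8 × x ≢ 0ℤ → ⊥
      refute (j , x , Y≡ , x<8 , x≢0) =
        x≢0 (≋0⇒≡0 (eighth*2^t-cancel j (subst (λ a → eighth ℤ.* a ≋ 0ℤ) Y≡ eighth*Y≋0)) (ℕP.<-≤-trans x<8 7<n))

  cycleOf : Vec (ℤ × VecExpr) 6 → (Fin 3 → Fin d) → Cyc
  cycleOf vs ρ = Vec.map (vertexOf ρ) vs

  InjectiveBelow : ℕ → (Fin 3 → Fin d) → Set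
  InjectiveBelow a ρ = ∀ i j → toℕ i ℕ.< a → toℕ j ℕ.< a → ρ i ≡ ρ j → i ≡ j

  record Realises (sh : Shape) (c : Cyc) : Set where
    constructor realised
    field
      parameters : Fin 3 → Fin d
      injective : InjectiveBelow (Shape.arity sh) parameters
      equation : c ≡ cycleOf (Shape.vertices sh) parameters

  one : Fin d → Fin 3 → Fin d
  one r _ = r

  pair : Fin d → Fin d → Fin 3 → Fin d
  pair r s zero = r
  pair r s (suc _) = s

  triple : Fin d → Fin d → Fin d → Fin 3 → Fin d
  triple r s t zero = r
  triple r s t (suc zero) = s
  triple r s t (suc (suc _)) = t

  private
    0<2 : 0 ℕ.< 2
    0<2 = s≤s z≤n
    1<2 : 1 ℕ.< 2
    1<2 = s≤s (s≤s z≤n)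
    0<3 : 0 ℕ.< 3
    0<3 = s≤s z≤n
    1<3 : 1 ℕ.< 3
    1<3 = s≤s (s≤s z≤n)
    2<3 : 2 ℕ.< 3
    2<3 = s≤s (s≤s (s≤s z≤n))

  injective-one : ∀ ρ → InjectiveBelow 1 ρ
  injective-one ρ zero zero _ _ _ = refl
  injective-one ρ (suc _) _ (s≤s ()) _ _
  injective-one ρ zero (suc _) _ (s≤s ()) _

  injective-pair : ∀ {r s} → r ≢ s → InjectiveBelow 2 (pair r s)
  injective-pair r≢s zero zero _ _ _ = refl
  injective-pair r≢s zero (suc zero) _ _ r≡s = ⊥-elim (r≢s r≡s)
  injective-pair r≢s (suc zero) zero _ _ s≡r = ⊥-elim (r≢s (sym s≡r))
  injective-pair r≢s (suc zero) (suc zero) _ _ _ = refl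
  injective-pair r≢s (suc (suc _)) _ (s≤s (s≤s ())) _ _
  injective-pair r≢s zero (suc (suc _)) _ (s≤s (s≤s ())) _
  injective-pair r≢s (suc zero) (suc (suc _)) _ (s≤s (s≤s ())) _

  injective-triple : ∀ {r s t} → Distinct3 r s t → InjectiveBelow 3 (triple r s t)
  injective-triple _ zero zero _ _ _ = refl
  injective-triple _ (suc zero) (suc zero) _ _ _ = refl
  injective-triple _ (suc (suc zero)) (suc (suc zero)) _ _ _ = refl
  injective-triple (r≢s , r≢t , s≢t) zero (suc zero) _ _ eq = ⊥-elim (r≢s eq)
  injective-triple (r≢s , r≢t , s≢t) zero (suc (suc zero)) _ _ eq = ⊥-elim (r≢t eq)
  injective-triple (r≢s , r≢t , s≢t) (suc zero) zero _ _ eq = ⊥-elim (r≢s (sym eq))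
  injective-triple (r≢s , r≢t , s≢t) (suc zero) (suc (suc zero)) _ _ eq = ⊥-elim (s≢t eq)
  injective-triple (r≢s , r≢t , s≢t) (suc (suc zero)) zero _ _ eq = ⊥-elim (r≢t (sym eq))
  injective-triple (r≢s , r≢t , s≢t) (suc (suc zero)) (suc zero) _ _ eq = ⊥-elim (s≢t (sym eq))

  distinct : ∀ {a ρ} → InjectiveBelow a ρ → (i j : Fin 3) → toℕ i ℕ.< a → toℕ j ℕ.< a → i ≢ j → ρ i ≢ ρ j
  distinct injective i j i<a j<a i≢j ρi≡ρj = i≢j (injective i j i<a j<a ρi≡ρj)

  realises₁ : ∀ {vs} → (∀ ρ → cycleOf vs ρ ≡ cycleOf vs (one (ρ zero))) →
              ∀ c → (∃[ r ] c ≡ cycleOf vs (one r)) ⇔ Realises (shape 1 vs) c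
  realises₁ uses c = mk⇔ (λ { (r , eq) → realised (one r) (injective-one (one r)) eq })
                          (λ { (realised ρ _ eq) → ρ zero , trans eq (uses ρ) })

  realises₂ : ∀ {vs} → (∀ ρ → cycleOf vs ρ ≡ cycleOf vs (pair (ρ zero) (ρ (suc zero)))) →
              ∀ c → (∃[ r ] ∃[ s ] r ≢ s × c ≡ cycleOf vs (pair r s)) ⇔ Realises (shape 2 vs) c
  realises₂ uses c = mk⇔ (λ { (r , s , r≢s , eq) → realised (pair r s) (injective-pair r≢s) eq })
                          (λ { (realised ρ inj eq) →
                                 ρ zero , ρ (suc zero) , distinct inj zero (suc zero) 0<2 1<2 (λ ()) , trans eq (uses ρ) })

  realises₃ : ∀ {vs} → (∀ ρ → cycleOf vs ρ ≡ cycleOf vs (triple (ρ zero) (ρ (suc zero)) (ρ (suc (suc zero))))) →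
              ∀ c → (∃[ r ] ∃[ s ] ∃[ t ] Distinct3 r s t × c ≡ cycleOf vs (triple r s t)) ⇔ Realises (shape 3 vs) c
  realises₃ uses c = mk⇔ (λ { (r , s , t , r≢s,t , eq) → realised (triple r s t) (injective-triple r≢s,t) eq })
                          (λ { (realised ρ inj eq) → ρ zero , ρ (suc zero) , ρ (suc (suc zero)) ,
                                 ( distinct inj zero (suc zero) 0<3 1<3 (λ ())
                                 , distinct inj zero (suc (suc zero)) 0<3 2<3 (λ ())
                                 , distinct inj (suc zero) (suc (suc zero)) 1<3 2<3 (λ ()) ) ,
                                 trans eq (uses ρ) })

  realisations : Pointwise (λ F sh → ∀ c → F c ⇔ Realises sh c) (Forms.forms h) shapes
  realisations =
      realises₁ (λ _ → refl) ∷ realises₁ (λ _ → refl) ∷ realises₂ (λ _ → refl) ∷ realises₁ (λ _ → refl)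
    ∷ realises₂ (λ _ → refl) ∷ realises₂ (λ _ → refl) ∷ realises₁ (λ _ → refl) ∷ realises₃ (λ _ → refl)
    ∷ realises₂ (λ _ → refl) ∷ realises₁ (λ _ → refl) ∷ realises₂ (λ _ → refl) ∷ realises₁ (λ _ → refl)
    ∷ realises₂ (λ _ → refl) ∷ realises₂ (λ _ → refl) ∷ realises₃ (λ _ → refl) ∷ realises₂ (λ _ → refl) ∷ []

  shapeOf : Template → Shape
  shapeOf t = shape (Template.arity t) (Template.vertices t)

  rev-involutive : ∀ c → rev (rev c) ≡ c
  rev-involutive (_ ∷ _ ∷ _ ∷ _ ∷ _ ∷ _ ∷ []) = refl

  rev-cycleOf : ∀ vs ρ → rev (cycleOf vs ρ) ≡ cycleOf (reverseCycle vs) ρ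
  rev-cycleOf (_ ∷ _ ∷ _ ∷ _ ∷ _ ∷ _ ∷ []) ρ = refl

  template-hasForm : ∀ i b {c} → Realises (shapeOf (template i b)) c → HasForm h i c
  template-hasForm i false {c} r = inj₁ (Equivalence.from (Pointwise.lookup realisations i c) r)
  template-hasForm i true {c} (realised ρ injective eq) =
    inj₂ (Equivalence.from (Pointwise.lookup realisations i (rev c))
           (realised ρ injective
               (trans (cong rev eq) (trans (rev-cycleOf _ ρ) (cong (λ vs → cycleOf vs ρ) (reverse-reverse _))))))
    where reverse-reverse : ∀ {A : Set} (v : Vec A 6) → reverseCycle (reverseCycle v) ≡ v
          reverse-reverse (_ ∷ _ ∷ _ ∷ _ ∷ _ ∷ _ ∷ []) = refl

  hasForm-template : ∀ i {c} → HasForm h i c → ∃[ b ] Realises (shapeOf (template i b)) c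
  hasForm-template i {c} (inj₁ f) = false , Equivalence.to (Pointwise.lookup realisations i c) f
  hasForm-template i {c} (inj₂ f) with Equivalence.to (Pointwise.lookup realisations i (rev c)) f
  ... | realised ρ injective eq = true , realised ρ injective
      (trans (sym (rev-involutive c)) (trans (cong rev eq) (rev-cycleOf _ ρ)))

  self-consistent : ∀ i b → T (selfConsistent (template i b))
  self-consistent i b = all-∈-true selfConsistent {templates} templates-consistent (∈-templates i b)

  covered : ∀ {sl} → Canonical sl → ∀ ds → T (misclosed ds ∨ settled templates ds sl)
  covered {sl} canonical ds = all-∈
      (λ ds → misclosed ds ∨ settled templates ds sl) {directionVectors} every-direction (∈-directionVectors ds)
    where
      every-direction : T (all (λ ds → misclosed ds ∨ settled templates ds sl) directionVectors)
      every-direction = modus-ponens {isCanonical sl}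
                          (all-∈-true (settledPattern templates) {candidatePatterns} patterns-settled
                              (canonical-candidate {sl} canonical))
                          (canonical-isCanonical {sl} canonical)

  expected-models : ∀ {σ ρ ρ′ sv} zE → (∀ i → ρ′ i ≡ ρ (σ i)) → T (matches σ zE sv) → Models ρ sv (vertexOf ρ′ zE)
  expected-models {σ} {ρ} {ρ′} {z′ , Y} (z , E) ρ′≡ match =
    models (subst (levelAt z Level.~_) (does-sound (z ℤP.≟ z′) (∧-proj₁ match)) (levelAt-~ z))
           (λ p → subst (λ t → lookup (⟦ E ⟧ ρ′) p ~ eighth ℤ.* t) (project-cong ρ p (λ s → sym (Y≡ s)))
                    (eval-models σ ρ ρ′ E ρ′≡ (∧-proj₁ rest) p))
    where
      rest = ∧-proj₂ {z == z′} match
      Y≡ : ∀ s → Y s ≡ eval σ E s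
      Y≡ s = does-sound (Y s ℤP.≟ eval σ E s) (all-allFin (λ s → Y s == eval σ E s) (∧-proj₂ {exact σ E} rest) s)

  models-resp : ∀ {ρ sv sv′ v} → T (sameVertex sv′ sv) → Models ρ sv v → Models ρ sv′ v
  models-resp {ρ} {z , Y} {z′ , Y′} same (models a~z coordinates) with sameVertex-sound {z′} {z} {Y′} {Y} same
  ... | refl , Y′≡Y = models a~z
      (λ p → subst (λ t → _ ~ eighth ℤ.* t) (project-cong ρ p (λ s → sym (Y′≡Y s))) (coordinates p))

  template-models : ∀ t (ρ₃ : Fin 3 → Fin d) → T (selfConsistent t) →
                    Pointwise (Models (ρ₃ ∘ cut)) (templateWalk t)
                                                  (closedWalk (cycleOf (Template.vertices t) ρ₃))
  template-models t ρ₃ consistent = pointwise-closedWalk at-vertex (models-resp closes (at-vertex zero))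
    where
      wt = templateWalk t
      matched : ∀ k → T (vertexMatches t emb wt k)
      matched = all-allFin (vertexMatches t emb wt) (∧-proj₁ (∧-proj₂ {Template.arity t ℕ.≤ᵇ 3} consistent))
      closes : T (sameVertex (finalVertex wt) start)
      closes = ∧-proj₂ {slotsBelowArity t}
          (∧-proj₂ {all (vertexMatches t emb wt) (allFin 6)} (∧-proj₂ {Template.arity t ℕ.≤ᵇ 3} consistent))
      at-vertex : ∀ k → Models (ρ₃ ∘ cut) (lookup wt (inject₁ k)) (lookup (cycleOf (Template.vertices t) ρ₃) k)
      at-vertex k = subst (Models (ρ₃ ∘ cut) (lookup wt (inject₁ k))) (sym (VecP.lookup-map k (vertexOf ρ₃) (Template.vertices t)))
                      (expected-models (lookup (Template.vertices t) k) (λ i → cong ρ₃ (sym (cut-emb i))) (matched k))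

  slots-below-arity : ∀ {t} → T (selfConsistent t) → ∀ k s → lookup (Template.slots t) k ≡ just s →
                      toℕ s ℕ.< Template.arity t
  slots-below-arity {t} consistent k s eq =
    ℕP.<ᵇ⇒< _ _ (subst (T ∘ fromMaybe true ∘ Data.Maybe.map below) eq
                  (all-allFin (λ k → fromMaybe true (Data.Maybe.map below (lookup (Template.slots t) k))) below-arity k))
    where
      below : Fin 6 → Bool
      below s = toℕ s ℕ.<ᵇ Template.arity t
      below-arity : T (slotsBelowArity t)
      below-arity = ∧-proj₁ {slotsBelowArity t} (∧-proj₂ {all (vertexMatches t emb (templateWalk t)) (allFin 6)}
                                                   (∧-proj₂ {Template.arity t ℕ.≤ᵇ 3} consistent))

  slot-parameters-injective : ∀ {t ρ₃} → T (selfConsistent t) → InjectiveBelow (Template.arity t) ρ₃ →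
                              InjectiveOn (λ s → toℕ s ℕ.< Template.arity t) (ρ₃ ∘ cut)
  slot-parameters-injective {t} consistent injective {s} {s′} s<a s′<a eq =
    trans (sym (emb-cut s (below-3 s<a)))
          (trans (cong emb (injective (cut s) (cut s′) (cut-below s<a) (cut-below s′<a) eq)) (emb-cut s′ (below-3 s′<a)))
    where
      a≤3 : Template.arity t ℕ.≤ 3
      a≤3 = ℕP.≤ᵇ⇒≤ _ _ (∧-proj₁ consistent)
      below-3 : ∀ {s} → toℕ s ℕ.< Template.arity t → toℕ s ℕ.< 3
      below-3 s<a = ℕP.<-≤-trans s<a a≤3
      cut-below : ∀ {s} → toℕ s ℕ.< Template.arity t → toℕ (cut s) ℕ.< Template.arity t
      cut-below {s} s<a = subst (ℕ._< Template.arity t)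
          (sym (trans (sym (FinP.toℕ-↑ˡ (cut s) 3)) (cong toℕ (emb-cut s (below-3 s<a))))) s<a

  module Cycle (default : Fin d) {vs : Vec Vertex 6} (w : Walk (closedWalk vs))
      (at-origin : Vec.head vs ≡ origin) where
    open Canonicalisation default (labels w)

    ds : Vec Bool 6
    ds = directions w

    ws : Vec SymVertex 7
    ws = walk start ds slots

    roots-injective : InjectiveOn (T ∘ isRoot slots) decode
    roots-injective r r′ = decode-injective (does-sound (MaybeP.≡-dec Fin._≟_ _ _) r) (does-sound (MaybeP.≡-dec Fin._≟_ _ _) r′)

    starts-at-origin : Vec.head (closedWalk vs) ≡ origin
    starts-at-origin = trans (closedWalk-head vs) at-origin

    not-misclosed : ¬ T (misclosed ds)
    not-misclosed mis = T-not (∧-proj₁ mis) (does-complete (finalLevel 0ℤ ds ℤP.≟ 0ℤ) (Level.≋0⇒≡0 closes bound))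
      where
        level-0 : ∀ {v} → v ≡ origin → proj₁ v Level.~ 0ℤ
        level-0 refl = Level.[]-~ 0
        closes : finalLevel 0ℤ ds Level.≋ 0ℤ
        closes = Level.≋-trans (Level.≋-sym (final-level w (level-0 starts-at-origin)))
                   (level-0 (trans (closedWalk-last vs) at-origin))
        bound : ∣ finalLevel 0ℤ ds ∣ ℕ.< m
        bound = ℕP.<-≤-trans (ℕP.<ᵇ⇒< _ 7 (∧-proj₂ {nonzero (finalLevel 0ℤ ds)} mis)) 6<m

    module Modelled (ranges : T (levelsInRange ws)) where
      modelled : Pointwise (Models decode) ws (closedWalk vs)
      modelled = walk-models w slots (subst (Models decode start) (sym starts-at-origin) (models-start decode))
                   (all-allFin (λ i → inRange (proj₁ (lookup ws i))) ranges) decodes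

      vertex-models : ∀ k → Models decode (lookup ws (inject₁ k)) (lookup vs k)
      vertex-models k = subst (Models decode _) (closedWalk-inject vs k) (Pointwise.lookup modelled (inject₁ k))

      returns-to-origin : ¬ T (cannotReturn slots ws)
      returns-to-origin = cannotReturn-sound {decode} {slots} {ws} roots-injective
                  (subst (Models decode (finalVertex ws)) (trans (closedWalk-last vs) at-origin)
                      (Pointwise.lookup modelled (fromℕ 6)))

      no-repeats : Unique vs → ¬ T (repeats (initial ws))
      no-repeats vertices-distinct r = repeats-sound (pointwise-initial modelled) r vertices-distinct

      fit-realises : ∀ {t} → T (fits templates ds slots ws t) → Realises (shapeOf t) vs
      fit-realises {t} fit = realised (decode ∘ σ) injective (Pointwise-≡⇒≡ (ext equation))
        where
          σ = paramSlots t slots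
          a = Template.arity t
          params : T (paramsDistinctRoots t slots)
          params = ∧-proj₁ (∧-proj₂ {Template.directions t ==ᵛ ds} fit)
          matched : ∀ k → T (vertexMatches t σ ws k)
          matched = all-allFin (vertexMatches t σ ws)
              (∧-proj₁ (∧-proj₂ {paramsDistinctRoots t slots} (∧-proj₂ {Template.directions t ==ᵛ ds} fit)))
          root : ∀ i → toℕ i ℕ.< a → T (isRoot slots (σ i))
          root i i<a = modus-ponens {toℕ i ℕ.<ᵇ a}
              (all-allFin (λ i → not (toℕ i ℕ.<ᵇ a) ∨ isRoot slots (σ i)) (∧-proj₁ params) i) (ℕP.<⇒<ᵇ i<a)
          separated : ∀ i j → toℕ i ℕ.< a → toℕ j ℕ.< a → σ i ≡ σ j → i ≡ j
          separated i j i<a j<a eq =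
            does-sound (i Fin.≟ j)
              (modus-ponens {(toℕ i ℕ.<ᵇ a) ∧ (toℕ j ℕ.<ᵇ a) ∧ (σ i ==ᶠ σ j)}
                (all-allFin (λ j → not ((toℕ i ℕ.<ᵇ a) ∧ (toℕ j ℕ.<ᵇ a) ∧ (σ i ==ᶠ σ j)) ∨ (i ==ᶠ j))
                  (all-allFin (λ i → all (λ j → not ((toℕ i ℕ.<ᵇ a) ∧ (toℕ j ℕ.<ᵇ a) ∧ (σ i ==ᶠ σ j)) ∨ (i ==ᶠ j))
                      (allFin 3))
                    (∧-proj₂ {all (λ i → not (toℕ i ℕ.<ᵇ a) ∨ isRoot slots (σ i)) (allFin 3)} params) i) j)
                (∧-intro (ℕP.<⇒<ᵇ i<a) (∧-intro (ℕP.<⇒<ᵇ j<a) (does-complete (σ i Fin.≟ σ j) eq))))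
          injective : InjectiveBelow a (decode ∘ σ)
          injective i j i<a j<a eq = separated i j i<a j<a (roots-injective (root i i<a) (root j j<a) eq)
          equation : ∀ k → lookup vs k ≡ lookup (cycleOf (Template.vertices t) (decode ∘ σ)) k
          equation k =
            trans (models-injective (vertex-models k) (expected-models (lookup (Template.vertices t) k) (λ _ → refl) (matched k))
                                    (λ _ → refl))
                  (sym (VecP.lookup-map k (vertexOf (decode ∘ σ)) (Template.vertices t)))

      only-form : ∀ {t} → T (uniqueForm templates t ds slots) → ∀ j → HasForm h j vs → Template.form t ≡ j
      only-form {t} uniq j has-j = same-form (hasForm-template j has-j)
        where
          same-form : ∃[ b ] Realises (shapeOf (template j b)) vs → Template.form t ≡ j
          same-form (b , realised ρ₃ injective₃ eq₃) =
            sym (does-sound (j Fin.≟ Template.form t)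
                   (modus-ponens {(Template.directions t′ ==ᵛ ds) ∧ samePattern (Template.slots t′) slots}
                     (all-∈ (λ t′ → not ((Template.directions t′ ==ᵛ ds) ∧ samePattern (Template.slots t′) slots)
                                    ∨ (Template.form t′ ==ᶠ Template.form t))
                            {templates} uniq (∈-templates j b))
                     (∧-intro directions-agree pattern-agrees)))
            where
              t′ = template j b
              consistent = self-consistent j b
              models′ : Pointwise (Models (ρ₃ ∘ cut)) (templateWalk t′) (closedWalk vs)
              models′ = subst (λ c → Pointwise (Models (ρ₃ ∘ cut)) (templateWalk t′) (closedWalk c)) (sym eq₃)
                  (template-models t′ ρ₃ consistent)
              agreement = walks-agree ds (Template.directions t′) slots (Template.slots t′) modelled models′
              directions-agree : T (Template.directions t′ ==ᵛ ds)
              directions-agree = does-complete (VecP.≡-dec BoolP._≟_ _ _) (sym (proj₁ agreement))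
              pattern-agrees : T (samePattern (Template.slots t′) slots)
              pattern-agrees =
                samePattern-complete {ρ = decode} {ρ₃ ∘ cut} {slots} {Template.slots t′}
                  roots-injective (slot-parameters-injective {t′} {ρ₃} consistent injective₃)
                  (λ k s eq → does-complete (MaybeP.≡-dec Fin._≟_ (lookup slots s) (just s)) (proj₂ (canonical k s eq)))
                  (slots-below-arity {t′} consistent) (proj₂ agreement)

      fit-classifies : ∀ {t} → t ∈ templates → T (fits templates ds slots ws t) → ExactlyOne (λ i → HasForm h i vs)
      fit-classifies {t} t∈ fit = Template.form t , has-form (templates-are t∈) , only-form {t} uniq
        where
          uniq : T (uniqueForm templates t ds slots)
          uniq = ∧-proj₂ {all (vertexMatches t (paramSlots t slots) ws) (allFin 6)}
                   (∧-proj₂ {paramsDistinctRoots t slots} (∧-proj₂ {Template.directions t ==ᵛ ds} fit))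
          has-form : ∃[ i ] ∃[ b ] t ≡ template i b → HasForm h (Template.form t) vs
          has-form (i , b , refl) = template-hasForm i b (fit-realises {template i b} fit)

    classification : Unique vs → ExactlyOne (λ i → HasForm h i vs)
    classification vertices-distinct = settle (∨-elim {misclosed ds} (covered canonical ds))
      where
        settle : T (misclosed ds) ⊎ T (settled templates ds slots) → ExactlyOne (λ i → HasForm h i vs)
        settle (inj₁ mis) = ⊥-elim (not-misclosed mis)
        settle (inj₂ g) = conclude (∨-elim {cannotReturn slots ws} (∧-proj₂ {levelsInRange ws} g))
          where
            open Modelled (∧-proj₁ {levelsInRange ws} g)
            matched : T (any (fits templates ds slots ws) templates) → ExactlyOne (λ i → HasForm h i vs)
            matched found = fit-classifies (proj₁ (proj₂ witness)) (proj₂ (proj₂ witness))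
              where witness = any-∃ (fits templates ds slots ws) templates found
            conclude : T (cannotReturn slots ws) ⊎ T (repeats (initial ws) ∨ any (fits templates ds slots ws) templates) →
                       ExactlyOne (λ i → HasForm h i vs)
            conclude (inj₁ fails) = ⊥-elim (returns-to-origin fails)
            conclude (inj₂ rest) = [ ⊥-elim ∘ no-repeats vertices-distinct , matched ]′
                (∨-elim {repeats (initial ws)} rest)

  six-cycles : Fin d → ∀ c → IsSixCycle c → Vec.head c ≡ origin → ExactlyOne (λ i → HasForm h i c)
  six-cycles default (v₀ ∷ v₁ ∷ v₂ ∷ v₃ ∷ v₄ ∷ v₅ ∷ [])
             (e₀ , e₁ , e₂ , e₃ , e₄ , e₅ ,
              n01 , n02 , n03 , n04 , n05 , n12 , n13 , n14 , n15 , n23 , n24 , n25 , n34 , n35 , n45) at-origin =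
    Cycle.classification default (e₀ ▸ e₁ ▸ e₂ ▸ e₃ ▸ e₄ ▸ e₅ ▸ stop) at-origin
      ((n01 ∷ n02 ∷ n03 ∷ n04 ∷ n05 ∷ []) ∷ (n12 ∷ n13 ∷ n14 ∷ n15 ∷ []) ∷ (n23 ∷ n24 ∷ n25 ∷ []) ∷
          (n34 ∷ n35 ∷ []) ∷ (n45 ∷ []) ∷ [] ∷ [])

first-coordinate : ∀ {k} → 1 < k → Fin (k ∸ 1)
first-coordinate {suc (suc _)} _ = zero
first-coordinate {suc zero} (s≤s ())

lemma3p2 : (k m n : ℕ) {{_ : NonZero m}} {{_ : NonZero n}} →
    1 < k → 6 < m → 7 < n → 2 ^ m % n ≡ 1 % n →
    (h : Fin n) → Zmod._*ₙ_ n h (Zmod.[_] n 2) ≡ Zmod.[_] n 1 →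
    (c : Bouwer.Cyc k m n) → Bouwer.IsSixCycle k m n c → head c ≡ Bouwer.origin k m n →
    ExactlyOne (λ i → Bouwer.HasForm k m n h i c)
lemma3p2 k m n 1<k 6<m 7<n 2^m%n≡1 h h*2≡1 =
  BouwerGraph.six-cycles k m n 6<m 7<n 2^m%n≡1 h h*2≡1 (first-coordinate 1<k)
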